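{- Let $p$ be a positive integer, $q=p^2-p+1$, and $n\ge3$. Let $P\subset\mathbb{R}^2$ be the convex pentagon with vertices $\pm q\mathbf{e}_1$, $\pm(q-1)\mathbf{e}_1+\mathbf{e}_2$, $\tfrac qp\mathbf{e}_2$; let $P'=\{(\mathbf{x},0,\dotsc,0)\in\mathbb{R}^n:\mathbf{x}\in P\}$ and $P_n=\mathrm{conv}(P'\cup\{\mathbf{e}_3,\dotsc,\mathbf{e}_n\})\subset\mathbb{R}^n$. Let $S_n=\mathrm{conv}\{\mathbf{0},-\tfrac1p\mathbf{e}_1,\mathbf{e}_2,\dotsc,\mathbf{e}_{n-1}\}\subset\mathbb{R}^{n-1}$ and $W_n=([-q,q]\times S_n)-q\mathbf{e}_2\subset\mathbb{R}^n$. Let $H_n=\mathrm{conv}(W_n\cup P_n)$. Then there is a polytope $M_n\subset\mathbb{R}^n$ such that $H_n=W_n\cup M_n\cup P_n$ and such that $W_n\cap M_n$, $M_n$, and $M_n\cap P_n$ are lattice polytopes (polytopes all of whose vertices lie in $\mathbb{Z}^n$).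
   Context: $\mathbf{e}_i$ denotes the $i$th standard basis vector of the relevant Euclidean space; $[-q,q]\subset\mathbb{R}$ is a closed segment, so $[-q,q]\times S_n\subset\mathbb{R}^n$.
   Formalization: Stated in ℚ^n in place of ℝ^n, so the polytopes P, P_n, S_n, W_n, H_n and M_n consist of points with rational coordinates and are convex hulls with rational coefficients. -}

module Defs where

open import Level using (0ℓ)
open import Data.Bool using (if_then_else_)
open import Data.Nat as ℕ using (ℕ; zero; suc; NonZero; pred; _≡ᵇ_)
open import Data.Fin using (Fin; toℕ) renaming (zero to fzero; suc to fsuc)
open import Data.Integer using (ℤ; +_)
open import Data.Rational using (ℚ; 0ℚ; 1ℚ; _+_; _*_; _≤_; -_; _/_)
open import Data.Product using (Σ; ∃; _×_; _,_)
open import Data.Sum using (_⊎_)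
open import Relation.Binary.PropositionalEquality using (_≡_)

-- Points of Q^n (coordinates indexed by Fin n; index 0 is e_1, index 1 is e_2, ...)
Point : ℕ → Set
Point n = Fin n → ℚ

PSet : ℕ → Set₁
PSet n = Point n → Set

_≋_ : ∀ {n} → Point n → Point n → Set
x ≋ y = ∀ j → x j ≡ y j

-- the standard basis vector with 0-based index k (e_{k+1} in the paper's numbering)
eN : ∀ {n} → ℕ → Point n
eN k j = if toℕ j ≡ᵇ k then 1ℚ else 0ℚ

Σᶠ : ∀ {k} → (Fin k → ℚ) → ℚ
Σᶠ {zero} f = 0ℚ
Σᶠ {suc k} f = f fzero + Σᶠ (λ i → f (fsuc i))

InConv : ∀ {n k} → (Fin k → Point n) → Point n → Set
InConv {n} {k} V x =
  Σ (Fin k → ℚ) λ c → (∀ i → 0ℚ ≤ c i) × (Σᶠ c ≡ 1ℚ)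
    × (∀ j → Σᶠ (λ i → c i * V i j) ≡ x j)

Conv : ∀ {n} → PSet n → PSet n
Conv {n} A x = Σ ℕ λ k → Σ (Fin k → Point n) λ V → (∀ i → A (V i)) × InConv V x

_∪ˢ_ : ∀ {n} → PSet n → PSet n → PSet n
(A ∪ˢ B) x = A x ⊎ B x

_∩ˢ_ : ∀ {n} → PSet n → PSet n → PSet n
(A ∩ˢ B) x = A x × B x

_≐_ : ∀ {n} → PSet n → PSet n → Set
A ≐ B = ∀ x → (A x → B x) × (B x → A x)

IsPolytope : ∀ {n} → PSet n → Set
IsPolytope {n} A = Σ ℕ λ k → Σ (Fin k → Point n) λ V → A ≐ (λ x → InConv V x)

toQ : ∀ {n} → (Fin n → ℤ) → Point n
toQ v j = v j / 1

IsLatticePolytope : ∀ {n} → PSet n → Set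
IsLatticePolytope {n} A =
  Σ ℕ λ k → Σ (Fin k → Fin n → ℤ) λ V → A ≐ (λ x → InConv (λ i → toQ (V i)) x)

headP : ∀ {n} → Point n → ℚ
headP {zero} x = 0ℚ
headP {suc n} x = x fzero

tailP : ∀ {n} → Point n → Point (pred n)
tailP {zero} x = x
tailP {suc n} x = λ j → x (fsuc j)

qℕ : ℕ → ℕ
qℕ p = p ℕ.* p ℕ.∸ p ℕ.+ 1

qQ : ℕ → ℚ
qQ p = + qℕ p / 1

pt2 : ℚ → ℚ → Point 2
pt2 a b fzero = a
pt2 a b (fsuc fzero) = b

emb2 : ∀ {n} → Point 2 → Point n
emb2 y j with toℕ j
... | 0 = y fzero
... | 1 = y (fsuc fzero)
... | suc (suc _) = 0ℚ

PentVert : (p : ℕ) → .{{NonZero p}} → PSet 2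
PentVert p y =
  (y ≋ pt2 (qQ p) 0ℚ) ⊎ (y ≋ pt2 (- qQ p) 0ℚ)
  ⊎ (y ≋ pt2 (qQ p + - 1ℚ) 1ℚ) ⊎ (y ≋ pt2 (- (qQ p + - 1ℚ)) 1ℚ)
  ⊎ (y ≋ pt2 0ℚ (+ qℕ p / p))

Pent : (p : ℕ) → .{{NonZero p}} → PSet 2
Pent p = Conv (PentVert p)

Pprime : (p : ℕ) → .{{NonZero p}} → (n : ℕ) → PSet n
Pprime p n x = Σ (Point 2) λ y → Pent p y × (x ≋ emb2 y)

EVerts : (n : ℕ) → PSet n
EVerts n x = Σ ℕ λ k → (2 ℕ.≤ k) × (k ℕ.< n) × (x ≋ eN k)

Pn : (p : ℕ) → .{{NonZero p}} → (n : ℕ) → PSet n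
Pn p n = Conv (Pprime p n ∪ˢ EVerts n)

SVert : (p : ℕ) → .{{NonZero p}} → (m : ℕ) → PSet m
SVert p m y =
  (y ≋ (λ _ → 0ℚ))
  ⊎ (y ≋ (λ j → - (+ 1 / p) * eN 0 j))
  ⊎ (Σ ℕ λ k → (1 ℕ.≤ k) × (k ℕ.< m) × (y ≋ eN k))

Sn : (p : ℕ) → .{{NonZero p}} → (m : ℕ) → PSet m
Sn p m = Conv (SVert p m)

Wn : (p : ℕ) → .{{NonZero p}} → (n : ℕ) → PSet n
Wn p n x =
  ((- qQ p) ≤ headP x) × (headP x ≤ qQ p)
  × Sn p (pred n) (tailP (λ j → x j + qQ p * eN 1 j))

Hn : (p : ℕ) → .{{NonZero p}} → (n : ℕ) → PSet n
Hn p n = Conv (Wn p n ∪ˢ Pn p n)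

-- Every set in the statement is invariant under permuting e₃, …, eₙ, and membership depends only on
-- x₃, …, xₙ ≥ 0 and the shadow (a, b, s) = (x₁, x₂, x₃ + ⋯ + xₙ). In shadow coordinates W_n, P_n and
-- H_n are cut out by explicit linear inequalities, and H_n splits along the hyperplanes b = -q and
-- b = 0 into W_n, P_n and the slab -q ≤ b ≤ 0 of H_n, which is M_n: the convex hull of (±q, -q) and
-- (±q, 0) in the plane x₃ = ⋯ = xₙ = 0 and of (±q, -q) + eₖ and eₖ (k ≥ 3). Its faces W_n ∩ M_n
-- (at b = -q) and M_n ∩ P_n (at b = 0) are spanned by integer points too. Each hull membership
-- reduces to the three-dimensional hull of a polygon at height s = 0 and one at height s = 1,
-- where it is witnessed by explicit convex combinations of vertices.

module Submission where

open import Defs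
open import Level using (0ℓ)
open import Algebra.Bundles using (CommutativeRing)
import Algebra.Properties.Semiring.Sum as SemiringSum
open import Data.Bool using (true; false)
open import Data.Empty using (⊥-elim)
open import Data.Fin using (Fin; toℕ; #_; _↑ˡ_; _↑ʳ_; combine; quotRem) renaming (zero to fzero; suc to fsuc)
open import Data.Fin.Properties using (toℕ<n; remQuot-combine)
open import Data.Integer as ℤ using (ℤ; +_)
import Data.Integer.Properties as ℤP
open import Data.List using (List; []; _∷_; lookup)
open import Data.Nat as ℕ using (ℕ; zero; suc; NonZero; z≤n; s≤s)
import Data.Nat.Properties as ℕP
open import Data.Product using (Σ; _×_; _,_; proj₁; proj₂)
open import Data.Rational using (ℚ; 0ℚ; 1ℚ; ½; _+_; _*_; -_; _-_; _/_; 1/_; toℚᵘ; Positive; positive; nonNegative; ≢-nonZero)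
import Data.Rational.Properties as ℚP
import Data.Rational.Unnormalised as ℚᵘ
import Data.Rational.Unnormalised.Properties as ℚᵘP
open import Data.Sum using (_⊎_; inj₁; inj₂; [_,_]′)
import Data.List.Relation.Unary.All as All
open All using (All; []) renaming (_∷_ to _▸_)
open import Data.Vec.Functional using (_++_; concat)
open import Data.Vec.Functional.Properties using (lookup-++ˡ; lookup-++ʳ)
import Data.Vec.Functional.Relation.Unary.All.Properties as VAll
open import Function using (_∘_)
open import Relation.Binary.Definitions using (Tri; tri<; tri≈; tri>)
open import Relation.Binary.PropositionalEquality
open import Relation.Nullary using (yes; no)
open import Relation.Nullary.Decidable using (dec⇒maybe)
open import Tactic.RingSolver using (solve)
import Tactic.RingSolver.Core.AlmostCommutativeRing as ACR

-- A module of its own, so that `_≤_` is the order of ℚ here and the order of ℕ in the statement.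
module Polytopes where

  open import Data.Rational using (_≤_; _<_)

  ring : ACR.AlmostCommutativeRing 0ℓ 0ℓ
  ring = ACR.fromCommutativeRing ℚP.+-*-commutativeRing (λ x → dec⇒maybe (0ℚ ℚP.≟ x))

  open SemiringSum (CommutativeRing.semiring ℚP.+-*-commutativeRing)
    using (sum; ∑-distrib-+; ∑-comm; *-distribˡ-sum; sum-replicate-zero)

  Σᶠ≡sum : ∀ {k} (f : Fin k → ℚ) → Σᶠ f ≡ sum f
  Σᶠ≡sum {zero} f = refl
  Σᶠ≡sum {suc k} f = cong (_+_ (f fzero)) (Σᶠ≡sum (λ i → f (fsuc i)))

  Σᶠ-cong : ∀ {k} {f g : Fin k → ℚ} → (∀ i → f i ≡ g i) → Σᶠ f ≡ Σᶠ g
  Σᶠ-cong {zero} f≗g = refl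
  Σᶠ-cong {suc k} f≗g = cong₂ _+_ (f≗g fzero) (Σᶠ-cong (λ i → f≗g (fsuc i)))

  Σᶠ-0 : ∀ {k} → Σᶠ {k} (λ _ → 0ℚ) ≡ 0ℚ
  Σᶠ-0 {k} = trans (Σᶠ≡sum {k} (λ _ → 0ℚ)) (sum-replicate-zero k)

  Σᶠ-+ : ∀ {k} (f g : Fin k → ℚ) → Σᶠ (λ i → f i + g i) ≡ Σᶠ f + Σᶠ g
  Σᶠ-+ f g = begin
    Σᶠ (λ i → f i + g i) ≡⟨ Σᶠ≡sum (λ i → f i + g i) ⟩
    sum (λ i → f i + g i) ≡⟨ ∑-distrib-+ f g ⟩
    sum f + sum g         ≡⟨ sym (cong₂ _+_ (Σᶠ≡sum f) (Σᶠ≡sum g)) ⟩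
    Σᶠ f + Σᶠ g           ∎
    where open ≡-Reasoning

  Σᶠ-*ˡ : ∀ {k} c (f : Fin k → ℚ) → Σᶠ (λ i → c * f i) ≡ c * Σᶠ f
  Σᶠ-*ˡ c f = begin
    Σᶠ (λ i → c * f i) ≡⟨ Σᶠ≡sum (λ i → c * f i) ⟩
    sum (λ i → c * f i) ≡⟨ sym (*-distribˡ-sum c f) ⟩
    c * sum f           ≡⟨ sym (cong (c *_) (Σᶠ≡sum f)) ⟩
    c * Σᶠ f            ∎
    where open ≡-Reasoning

  Σᶠ-*ʳ : ∀ {k} c (f : Fin k → ℚ) → Σᶠ (λ i → f i * c) ≡ Σᶠ f * c
  Σᶠ-*ʳ c f = trans (Σᶠ-cong (λ i → ℚP.*-comm (f i) c)) (trans (Σᶠ-*ˡ c f) (ℚP.*-comm c (Σᶠ f)))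

  Σᶠ-comm : ∀ {k l} (F : Fin k → Fin l → ℚ) →
            Σᶠ (λ i → Σᶠ (λ j → F i j)) ≡ Σᶠ (λ j → Σᶠ (λ i → F i j))
  Σᶠ-comm F = begin
    Σᶠ (λ i → Σᶠ (F i))                 ≡⟨ Σᶠ-cong (λ i → Σᶠ≡sum (F i)) ⟩
    Σᶠ (λ i → sum (F i))                ≡⟨ Σᶠ≡sum (λ i → sum (F i)) ⟩
    sum (λ i → sum (F i))               ≡⟨ ∑-comm F ⟩
    sum (λ j → sum (λ i → F i j))       ≡⟨ sym (Σᶠ≡sum (λ j → sum (λ i → F i j))) ⟩
    Σᶠ (λ j → sum (λ i → F i j))        ≡⟨ sym (Σᶠ-cong (λ j → Σᶠ≡sum (λ i → F i j))) ⟩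
    Σᶠ (λ j → Σᶠ (λ i → F i j))         ∎
    where open ≡-Reasoning

  Σᶠ-↑ : ∀ a {b} (h : Fin (a ℕ.+ b) → ℚ) → Σᶠ h ≡ Σᶠ (λ i → h (i ↑ˡ b)) + Σᶠ (λ i → h (a ↑ʳ i))
  Σᶠ-↑ zero h = sym (ℚP.+-identityˡ (Σᶠ h))
  Σᶠ-↑ (suc a) {b} h = trans (cong (_+_ (h fzero)) (Σᶠ-↑ a (λ i → h (fsuc i))))
    (sym (ℚP.+-assoc (h fzero) (Σᶠ (λ i → h (fsuc (i ↑ˡ b)))) (Σᶠ (λ i → h (fsuc (a ↑ʳ i))))))

  Σᶠ-combine : ∀ k {l} (h : Fin (k ℕ.* l) → ℚ) → Σᶠ h ≡ Σᶠ {k} (λ i → Σᶠ {l} (λ j → h (combine i j)))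
  Σᶠ-combine zero h = refl
  Σᶠ-combine (suc k) {l} h =
    trans (Σᶠ-↑ l {k ℕ.* l} h) (cong (_+_ (Σᶠ {l} (λ j → h (j ↑ˡ (k ℕ.* l))))) (Σᶠ-combine k {l} (λ i → h (l ↑ʳ i))))

  Σᶠ-mono : ∀ {k} {f g : Fin k → ℚ} → (∀ i → f i ≤ g i) → Σᶠ f ≤ Σᶠ g
  Σᶠ-mono {zero} f≤g = ℚP.≤-refl
  Σᶠ-mono {suc k} f≤g = ℚP.+-mono-≤ (f≤g fzero) (Σᶠ-mono (λ i → f≤g (fsuc i)))

  Σᶠ-nonNeg : ∀ {k} {f : Fin k → ℚ} → (∀ i → 0ℚ ≤ f i) → 0ℚ ≤ Σᶠ f
  Σᶠ-nonNeg {k} {f} f≥0 = subst (_≤ Σᶠ f) (Σᶠ-0 {k}) (Σᶠ-mono f≥0)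

  term≤Σᶠ : ∀ {k} {f : Fin k → ℚ} → (∀ i → 0ℚ ≤ f i) → ∀ i → f i ≤ Σᶠ f
  term≤Σᶠ {suc k} {f} f≥0 fzero =
    subst (_≤ f fzero + Σᶠ (λ i → f (fsuc i))) (ℚP.+-identityʳ (f fzero))
          (ℚP.+-mono-≤ (ℚP.≤-refl {f fzero}) (Σᶠ-nonNeg (λ i → f≥0 (fsuc i))))
  term≤Σᶠ {suc k} {f} f≥0 (fsuc i) =
    subst (_≤ f fzero + Σᶠ (λ i → f (fsuc i))) (ℚP.+-identityˡ (f (fsuc i)))
          (ℚP.+-mono-≤ (f≥0 fzero) (term≤Σᶠ (λ i → f≥0 (fsuc i)) i))

  Σᶠ-select : ∀ {m} (f : Fin m → ℚ) (k : Fin m) → Σᶠ (λ j → f j * eN (toℕ k) j) ≡ f k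
  Σᶠ-select {suc m} f fzero = begin
    f fzero * 1ℚ + Σᶠ (λ j → f (fsuc j) * 0ℚ) ≡⟨ cong₂ _+_ (ℚP.*-identityʳ (f fzero)) (Σᶠ-cong (λ j → ℚP.*-zeroʳ (f (fsuc j)))) ⟩
    f fzero + Σᶠ {m} (λ _ → 0ℚ)               ≡⟨ trans (cong (_+_ (f fzero)) (Σᶠ-0 {m})) (ℚP.+-identityʳ (f fzero)) ⟩
    f fzero                                   ∎
    where open ≡-Reasoning
  Σᶠ-select f (fsuc k) =
    trans (cong₂ _+_ (ℚP.*-zeroʳ (f fzero)) (Σᶠ-select (λ j → f (fsuc j)) k)) (ℚP.+-identityˡ (f (fsuc k)))

  eN-sym : ∀ {m} (k l : Fin m) → eN (toℕ k) l ≡ eN (toℕ l) k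
  eN-sym fzero fzero = refl
  eN-sym fzero (fsuc l) = refl
  eN-sym (fsuc k) fzero = refl
  eN-sym (fsuc k) (fsuc l) = eN-sym k l

  Σᶠ-select′ : ∀ {m} (f : Fin m → ℚ) (l : Fin m) → Σᶠ (λ k → f k * eN (toℕ k) l) ≡ f l
  Σᶠ-select′ f l = trans (Σᶠ-cong (λ k → cong (f k *_) (eN-sym k l))) (Σᶠ-select f l)

  Σᶠ-eN : ∀ {m} k → k ℕ.< m → Σᶠ {m} (eN k) ≡ 1ℚ
  Σᶠ-eN {suc m} zero _ = trans (cong (_+_ 1ℚ) (Σᶠ-0 {m})) (ℚP.+-identityʳ 1ℚ)
  Σᶠ-eN {suc m} (suc k) (ℕ.s≤s k<m) = trans (ℚP.+-identityˡ _) (Σᶠ-eN k k<m)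

  0≤1 : 0ℚ ≤ 1ℚ
  0≤1 = ℚP.<⇒≤ (ℚP.positive⁻¹ 1ℚ)

  eN-nonNeg : ∀ {n} k (j : Fin n) → 0ℚ ≤ eN k j
  eN-nonNeg k j with toℕ j ℕ.≡ᵇ k
  ... | true = 0≤1
  ... | false = ℚP.≤-refl

  slack : ∀ {p q} → p ≤ q → 0ℚ ≤ q - p
  slack {p} {q} p≤q = subst (_≤ q - p) (ℚP.+-inverseʳ p) (ℚP.+-monoˡ-≤ (- p) p≤q)

  0≤q-p⇒p≤q : ∀ {p q} → 0ℚ ≤ q - p → p ≤ q
  0≤q-p⇒p≤q {p} {q} 0≤q-p = subst₂ _≤_ (ℚP.+-identityˡ p) q-p+p≡q (ℚP.+-monoˡ-≤ p 0≤q-p)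
    where
    q-p+p≡q : q - p + p ≡ q
    q-p+p≡q = solve (p ∷ q ∷ []) ring

  -- All inequalities below are certified this way: r is a nonnegative combination of slacks and
  -- `solve` checks q - p ≡ r; the certificate comes first so that the solver sees a closed goal.
  ≤-from : ∀ {p q r} → 0ℚ ≤ r → q - p ≡ r → p ≤ q
  ≤-from 0≤r q-p≡r = 0≤q-p⇒p≤q (subst (0ℚ ≤_) (sym q-p≡r) 0≤r)

  -- For the same reason: `trans-sym z≡y (solve …)` lets the solver see y.
  trans-sym : ∀ {x y z : ℚ} → z ≡ y → x ≡ y → x ≡ z
  trans-sym z≡y x≡y = trans x≡y (sym z≡y)

  nonNeg-+ : ∀ {p q} → 0ℚ ≤ p → 0ℚ ≤ q → 0ℚ ≤ p + q
  nonNeg-+ = ℚP.+-mono-≤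

  nonNeg-cancelˡ : ∀ {r p} → 0ℚ < r → 0ℚ ≤ r * p → 0ℚ ≤ p
  nonNeg-cancelˡ {r} {p} 0<r 0≤rp =
    ℚP.*-cancelˡ-≤-pos r {{positive 0<r}} (subst (_≤ r * p) (sym (ℚP.*-zeroʳ r)) 0≤rp)

  nonNeg-* : ∀ {p q} → 0ℚ ≤ p → 0ℚ ≤ q → 0ℚ ≤ p * q
  nonNeg-* {p} {q} 0≤p 0≤q =
    ℚP.nonNegative⁻¹ (p * q) {{ℚP.nonNeg*nonNeg⇒nonNeg p {{nonNegative 0≤p}} q {{nonNegative 0≤q}}}}

  -- recip 0 = 0
  recip : ℚ → ℚ
  recip p with p ℚP.≟ 0ℚ
  ... | yes _ = 0ℚ
  ... | no p≢0 = (1/ p) {{≢-nonZero p≢0}}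

  recip-nonNeg : ∀ {p} → 0ℚ ≤ p → 0ℚ ≤ recip p
  recip-nonNeg {p} 0≤p with p ℚP.≟ 0ℚ
  ... | yes _ = ℚP.≤-refl
  ... | no p≢0 = ℚP.<⇒≤ (ℚP.positive⁻¹ _ {{ℚP.1/pos⇒pos p {{p>0}}}})
    where
    p>0 : Positive p
    p>0 = ℚP.nonNeg∧nonZero⇒pos p {{nonNegative 0≤p}} {{≢-nonZero p≢0}}

  *-recip-absorbs : ∀ {p q} → 0ℚ ≤ p → p ≤ q → p * (q * recip q) ≡ p
  *-recip-absorbs {p} {q} 0≤p p≤q with q ℚP.≟ 0ℚ
  ... | yes refl = trans (cong (_* (0ℚ * 0ℚ)) p≡0) (sym p≡0)
    where
    p≡0 : p ≡ 0ℚ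
    p≡0 = ℚP.≤-antisym p≤q 0≤p
  ... | no q≢0 = trans (cong (p *_) (ℚP.*-inverseʳ q {{≢-nonZero q≢0}})) (ℚP.*-identityʳ p)

  *-recip≤1 : ∀ q → q * recip q ≤ 1ℚ
  *-recip≤1 q with q ℚP.≟ 0ℚ
  ... | yes refl = 0≤1
  ... | no q≢0 = ℚP.≤-reflexive (ℚP.*-inverseʳ q {{≢-nonZero q≢0}})

  OnSegment : ℚ → ℚ → ℚ → Set
  OnSegment l u x = Σ ℚ λ t → 0ℚ ≤ t × t ≤ 1ℚ × x ≡ (1ℚ - t) * l + t * u

  interval-point : ∀ {l u x} → l ≤ x → x ≤ u → OnSegment l u x
  interval-point {l} {u} {x} l≤x x≤u = (x - l) * recip (u - l) , 0≤t , t≤1 , x≡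
    where
    0≤x-l : 0ℚ ≤ x - l
    0≤x-l = slack l≤x
    x-l≤u-l : x - l ≤ u - l
    x-l≤u-l = ℚP.+-monoˡ-≤ (- l) x≤u
    0≤r : 0ℚ ≤ recip (u - l)
    0≤r = recip-nonNeg (ℚP.≤-trans 0≤x-l x-l≤u-l)
    0≤t : 0ℚ ≤ (x - l) * recip (u - l)
    0≤t = nonNeg-* 0≤x-l 0≤r
    t≤1 : (x - l) * recip (u - l) ≤ 1ℚ
    t≤1 = ℚP.≤-trans (ℚP.*-monoʳ-≤-nonNeg (recip (u - l)) {{nonNegative 0≤r}} x-l≤u-l) (*-recip≤1 (u - l))
    rearrange : ∀ r → l + (x - l) * ((u - l) * r) ≡ (1ℚ - (x - l) * r) * l + (x - l) * r * u
    rearrange r = solve (l ∷ u ∷ x ∷ r ∷ []) ring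
    x≡ : x ≡ (1ℚ - (x - l) * recip (u - l)) * l + (x - l) * recip (u - l) * u
    x≡ = begin
      x                                        ≡⟨ solve (l ∷ x ∷ []) ring ⟩
      l + (x - l)                              ≡⟨ cong (_+_ l) (sym (*-recip-absorbs 0≤x-l x-l≤u-l)) ⟩
      l + (x - l) * ((u - l) * recip (u - l))  ≡⟨ rearrange (recip (u - l)) ⟩
      (1ℚ - (x - l) * recip (u - l)) * l + (x - l) * recip (u - l) * u ∎
      where open ≡-Reasoning

  Σᶠ-convex-≤ : ∀ {k} {c g : Fin k → ℚ} {r} → (∀ i → 0ℚ ≤ c i) → Σᶠ c ≡ 1ℚ →
                (∀ i → g i ≤ r) → Σᶠ (λ i → c i * g i) ≤ r
  Σᶠ-convex-≤ {c = c} {g} {r} c≥0 Σc≡1 g≤r = subst (Σᶠ (λ i → c i * g i) ≤_) Σcr≡r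
    (Σᶠ-mono (λ i → ℚP.*-monoˡ-≤-nonNeg (c i) {{nonNegative (c≥0 i)}} (g≤r i)))
    where
    Σcr≡r : Σᶠ (λ i → c i * r) ≡ r
    Σcr≡r = trans (Σᶠ-*ʳ r c) (trans (cong (_* r) Σc≡1) (ℚP.*-identityˡ r))

  Σᶠ-nonNeg-* : ∀ {k} {c g : Fin k → ℚ} → (∀ i → 0ℚ ≤ c i) → (∀ i → 0ℚ ≤ g i) → 0ℚ ≤ Σᶠ (λ i → c i * g i)
  Σᶠ-nonNeg-* c≥0 g≥0 = Σᶠ-nonNeg (λ i → nonNeg-* (c≥0 i) (g≥0 i))

  -- Convex hulls and affine maps

  module _ {n k : ℕ} {V : Fin k → Point n} where

    InConv-resp-≋ : ∀ {x y} → x ≋ y → InConv V x → InConv V y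
    InConv-resp-≋ x≋y (c , c≥0 , Σc≡1 , coords) = c , c≥0 , Σc≡1 , λ j → trans (coords j) (x≋y j)

    InConv-vertex : ∀ i → InConv V (V i)
    InConv-vertex i = eN (toℕ i) , eN-nonNeg (toℕ i) , Σᶠ-eN (toℕ i) (toℕ<n i) ,
                      λ j → trans (Σᶠ-cong (λ l → ℚP.*-comm (eN (toℕ i) l) (V l j))) (Σᶠ-select (λ l → V l j) i)

    InConv-mix : ∀ {x y} t → 0ℚ ≤ t → t ≤ 1ℚ → InConv V x → InConv V y →
                 InConv V (λ j → t * x j + (1ℚ - t) * y j)
    InConv-mix {x} {y} t 0≤t t≤1 (c , c≥0 , Σc≡1 , cx) (d , d≥0 , Σd≡1 , dy) = e , e≥0 , Σe≡1 , ey
      where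
      e : Fin k → ℚ
      e i = t * c i + (1ℚ - t) * d i
      e≥0 : ∀ i → 0ℚ ≤ e i
      e≥0 i = nonNeg-+ (nonNeg-* 0≤t (c≥0 i)) (nonNeg-* (slack t≤1) (d≥0 i))
      Σ-mix : (f g : Fin k → ℚ) → Σᶠ (λ i → t * f i + (1ℚ - t) * g i) ≡ t * Σᶠ f + (1ℚ - t) * Σᶠ g
      Σ-mix f g = trans (Σᶠ-+ (λ i → t * f i) (λ i → (1ℚ - t) * g i)) (cong₂ _+_ (Σᶠ-*ˡ t f) (Σᶠ-*ˡ (1ℚ - t) g))
      Σe≡1 : Σᶠ e ≡ 1ℚ
      Σe≡1 = trans (Σ-mix c d) (trans (cong₂ (λ p q → t * p + (1ℚ - t) * q) Σc≡1 Σd≡1) (solve (t ∷ []) ring))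
      distrib : ∀ p q v → (t * p + (1ℚ - t) * q) * v ≡ t * (p * v) + (1ℚ - t) * (q * v)
      distrib p q v = solve (t ∷ p ∷ q ∷ v ∷ []) ring
      ey : ∀ j → Σᶠ (λ i → e i * V i j) ≡ t * x j + (1ℚ - t) * y j
      ey j = trans (Σᶠ-cong (λ i → distrib (c i) (d i) (V i j)))
                   (trans (Σ-mix (λ i → c i * V i j) (λ i → d i * V i j)) (cong₂ (λ p q → t * p + (1ℚ - t) * q) (cx j) (dy j)))

    InConv-nonNeg : ∀ {x} j → (∀ i → 0ℚ ≤ V i j) → InConv V x → 0ℚ ≤ x j
    InConv-nonNeg j V≥0 (c , c≥0 , _ , coords) = subst (0ℚ ≤_) (coords j) (Σᶠ-nonNeg-* c≥0 V≥0)

  InConv-resp-vertices : ∀ {n k} {V W : Fin k → Point n} {x} → (∀ i → V i ≋ W i) → InConv V x → InConv W x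
  InConv-resp-vertices V≋W (c , c≥0 , Σc≡1 , coords) =
    c , c≥0 , Σc≡1 , λ j → trans (Σᶠ-cong (λ i → cong (c i *_) (sym (V≋W i j)))) (coords j)

  Conv-nonNeg : ∀ {n} {R : PSet n} {x} j → (∀ y → R y → 0ℚ ≤ y j) → Conv R x → 0ℚ ≤ x j
  Conv-nonNeg j R≥0 (_ , V , V∈R , h) = InConv-nonNeg j (λ i → R≥0 (V i) (V∈R i)) h

  Conv-singleton : ∀ {n} {R : PSet n} {y} → R y → Conv R y
  Conv-singleton {y = y} y∈R = 1 , (λ _ → y) , (λ _ → y∈R) , InConv-vertex {V = λ _ → y} fzero

  Affine : ∀ {n} → (Point n → ℚ) → Set
  Affine {n} φ = ∀ {k} {V : Fin k → Point n} {x} (h : InConv V x) → φ x ≡ Σᶠ (λ i → proj₁ h i * φ (V i))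

  coord-affine : ∀ {n} (j : Fin n) → Affine (λ x → x j)
  coord-affine j (_ , _ , _ , coords) = sym (coords j)

  Σ-coords-affine : ∀ {n l} (g : Fin l → Fin n) → Affine (λ x → Σᶠ (λ k → x (g k)))
  Σ-coords-affine g {V = V} {x} (c , _ , _ , coords) = begin
    Σᶠ (λ k → x (g k))                          ≡⟨ Σᶠ-cong (λ k → sym (coords (g k))) ⟩
    Σᶠ (λ k → Σᶠ (λ i → c i * V i (g k)))      ≡⟨ Σᶠ-comm (λ k i → c i * V i (g k)) ⟩
    Σᶠ (λ i → Σᶠ (λ k → c i * V i (g k)))      ≡⟨ Σᶠ-cong (λ i → Σᶠ-*ˡ (c i) (λ k → V i (g k))) ⟩
    Σᶠ (λ i → c i * Σᶠ (λ k → V i (g k)))      ∎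
    where open ≡-Reasoning

  zero-affine : ∀ {n} → Affine {n} (λ _ → 0ℚ)
  zero-affine {k = k} (c , _) = sym (trans (Σᶠ-cong (λ i → ℚP.*-zeroʳ (c i))) (Σᶠ-0 {k}))

  record Shadow (n : ℕ) : Set where
    field
      a b s : Point n → ℚ
      a-affine : Affine a
      b-affine : Affine b
      s-affine : Affine s

  infix 5.5 _·a+_·b+_·s≤_

  record Ineq : Set where
    constructor _·a+_·b+_·s≤_
    field
      α β γ r : ℚ

  holds : ℚ → ℚ → ℚ → Ineq → Set
  holds a b s (α ·a+ β ·b+ γ ·s≤ r) = α * a + β * b + γ * s ≤ r

  ⟦_⟧ : List Ineq → ℚ → ℚ → ℚ → Set
  ⟦ L ⟧ a b s = All (holds a b s) L

  Σᶠ-lin₃ : ∀ {k} (c f g h : Fin k → ℚ) α β γ →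
            Σᶠ (λ i → c i * (α * f i + β * g i + γ * h i)) ≡
            α * Σᶠ (λ i → c i * f i) + β * Σᶠ (λ i → c i * g i) + γ * Σᶠ (λ i → c i * h i)
  Σᶠ-lin₃ c f g h α β γ = begin
    Σᶠ (λ i → c i * (α * f i + β * g i + γ * h i))
      ≡⟨ Σᶠ-cong (λ i → distrib (c i) (f i) (g i) (h i)) ⟩
    Σᶠ (λ i → α * (c i * f i) + β * (c i * g i) + γ * (c i * h i))
      ≡⟨ Σᶠ-+ (λ i → α * (c i * f i) + β * (c i * g i)) (λ i → γ * (c i * h i)) ⟩
    Σᶠ (λ i → α * (c i * f i) + β * (c i * g i)) + Σᶠ (λ i → γ * (c i * h i))
      ≡⟨ cong (_+ Σᶠ (λ i → γ * (c i * h i))) (Σᶠ-+ (λ i → α * (c i * f i)) (λ i → β * (c i * g i))) ⟩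
    Σᶠ (λ i → α * (c i * f i)) + Σᶠ (λ i → β * (c i * g i)) + Σᶠ (λ i → γ * (c i * h i))
      ≡⟨ cong₂ _+_ (cong₂ _+_ (Σᶠ-*ˡ α (λ i → c i * f i)) (Σᶠ-*ˡ β (λ i → c i * g i))) (Σᶠ-*ˡ γ (λ i → c i * h i)) ⟩
    α * Σᶠ (λ i → c i * f i) + β * Σᶠ (λ i → c i * g i) + γ * Σᶠ (λ i → c i * h i) ∎
    where
    open ≡-Reasoning
    distrib : ∀ c f g h → c * (α * f + β * g + γ * h) ≡ α * (c * f) + β * (c * g) + γ * (c * h)
    distrib c f g h = solve (c ∷ f ∷ g ∷ h ∷ α ∷ β ∷ γ ∷ []) ring

  module _ {n} (σ : Shadow n) where
    open Shadow σ

    InConv-holds : ∀ {k} {V : Fin k → Point n} {x} ι → InConv V x →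
                   (∀ i → holds (a (V i)) (b (V i)) (s (V i)) ι) → holds (a x) (b x) (s x) ι
    InConv-holds {V = V} {x} (α ·a+ β ·b+ γ ·s≤ r) h@(c , c≥0 , Σc≡1 , _) Vᵢ-holds =
      subst (_≤ r) value (Σᶠ-convex-≤ c≥0 Σc≡1 Vᵢ-holds)
      where
      value : Σᶠ (λ i → c i * (α * a (V i) + β * b (V i) + γ * s (V i))) ≡ α * a x + β * b x + γ * s x
      value = trans (Σᶠ-lin₃ c (a ∘ V) (b ∘ V) (s ∘ V) α β γ)
                    (sym (cong₂ _+_ (cong₂ _+_ (cong (α *_) (a-affine h)) (cong (β *_) (b-affine h))) (cong (γ *_) (s-affine h))))

    InConv-⟦⟧ : ∀ {k} {V : Fin k → Point n} {x} L → InConv V x →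
                (∀ i → ⟦ L ⟧ (a (V i)) (b (V i)) (s (V i))) → ⟦ L ⟧ (a x) (b x) (s x)
    InConv-⟦⟧ [] h _ = []
    InConv-⟦⟧ (ι ∷ L) h Vᵢ∈L = InConv-holds ι h (All.head ∘ Vᵢ∈L) ▸ InConv-⟦⟧ L h (All.tail ∘ Vᵢ∈L)

    Conv-⟦⟧ : ∀ {R : PSet n} {x} L → (∀ y → R y → ⟦ L ⟧ (a y) (b y) (s y)) → Conv R x → ⟦ L ⟧ (a x) (b x) (s x)
    Conv-⟦⟧ L R⊆L (_ , V , V∈R , h) = InConv-⟦⟧ L h (λ i → R⊆L (V i) (V∈R i))

  -- Prismatoids

  concat-combine : ∀ {A : Set} {K m} (F : Fin K → Fin m → A) i k → concat F (combine i k) ≡ F i k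
  concat-combine {m = m} F i k = cong (λ (ik : _ × _) → F (proj₁ ik) (proj₂ ik)) (remQuot-combine {k = m} i k)

  concat⁺ : ∀ {A : Set} {K m} (P : A → Set) {F : Fin K → Fin m → A} → (∀ i k → P (F i k)) → ∀ ι → P (concat F ι)
  concat⁺ {K = K} {m} P P-F ι = P-F (proj₂ (quotRem {K} m ι)) (proj₁ (quotRem {K} m ι))

  Σᶠ-++ : ∀ {A : Set} {K₀ K₁} (c : Fin (K₀ ℕ.+ K₁) → ℚ) (φ : A → ℚ) (f : Fin K₀ → A) (g : Fin K₁ → A) →
          Σᶠ (λ ι → c ι * φ ((f ++ g) ι)) ≡
          Σᶠ (λ i → c (i ↑ˡ K₁) * φ (f i)) + Σᶠ (λ i → c (K₀ ↑ʳ i) * φ (g i))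
  Σᶠ-++ {K₀ = K₀} {K₁} c φ f g = trans (Σᶠ-↑ K₀ (λ ι → c ι * φ ((f ++ g) ι)))
    (cong₂ _+_ (Σᶠ-cong (λ i → cong (λ y → c (i ↑ˡ K₁) * φ y) (lookup-++ˡ f g i)))
               (Σᶠ-cong (λ i → cong (λ y → c (K₀ ↑ʳ i) * φ y) (lookup-++ʳ f g i))))

  Σᶠ-concat : ∀ {A : Set} {K m} (c : Fin (K ℕ.* m) → ℚ) (φ : A → ℚ) (F : Fin K → Fin m → A) →
              Σᶠ (λ ι → c ι * φ (concat F ι)) ≡ Σᶠ {K} (λ i → Σᶠ {m} (λ k → c (combine i k) * φ (F i k)))
  Σᶠ-concat {K = K} {m} c φ F = trans (Σᶠ-combine K (λ ι → c ι * φ (concat F ι)))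
    (Σᶠ-cong (λ i → Σᶠ-cong (λ k → cong (λ y → c (combine i k) * φ y) (concat-combine F i k))))

  pt3 : ℚ → ℚ → ℚ → Point 3
  pt3 a b s fzero = a
  pt3 a b s (fsuc fzero) = b
  pt3 a b s (fsuc (fsuc fzero)) = s

  at-level : ℚ → ℚ × ℚ → Point 3
  at-level h (u , v) = pt3 u v h

  prismatoid₃ : ∀ {K₀ K₁} → (Fin K₀ → ℚ × ℚ) → (Fin K₁ → ℚ × ℚ) → Fin (K₀ ℕ.+ K₁) → Point 3
  prismatoid₃ U₀ U₁ = (at-level 0ℚ ∘ U₀) ++ (at-level 1ℚ ∘ U₁)

  -- A record rather than a synonym, so that unification reads U₀, U₁, a, b, s off a goal.
  record Hull₃ {K₀ K₁} (U₀ : Fin K₀ → ℚ × ℚ) (U₁ : Fin K₁ → ℚ × ℚ) (a b s : ℚ) : Set where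
    constructor hull₃
    field
      convex-combination : InConv (prismatoid₃ U₀ U₁) (pt3 a b s)

  module Hull₃-Properties {K₀ K₁} (U₀ : Fin K₀ → ℚ × ℚ) (U₁ : Fin K₁ → ℚ × ℚ) where

    Hull₃-base : ∀ i {u v} → U₀ i ≡ (u , v) → Hull₃ U₀ U₁ u v 0ℚ
    Hull₃-base i refl = hull₃ (InConv-resp-≋ (λ j → cong (λ y → y j) (lookup-++ˡ (at-level 0ℚ ∘ U₀) (at-level 1ℚ ∘ U₁) i))
                                             (InConv-vertex (i ↑ˡ K₁)))

    Hull₃-top : ∀ i {u v} → U₁ i ≡ (u , v) → Hull₃ U₀ U₁ u v 1ℚ
    Hull₃-top i refl = hull₃ (InConv-resp-≋ (λ j → cong (λ y → y j) (lookup-++ʳ (at-level 0ℚ ∘ U₀) (at-level 1ℚ ∘ U₁) i))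
                                            (InConv-vertex (K₀ ↑ʳ i)))

    Hull₃-mix : ∀ {a b s a′ b′ s′} t → 0ℚ ≤ t → t ≤ 1ℚ → Hull₃ U₀ U₁ a b s → Hull₃ U₀ U₁ a′ b′ s′ →
                Hull₃ U₀ U₁ (t * a + (1ℚ - t) * a′) (t * b + (1ℚ - t) * b′) (t * s + (1ℚ - t) * s′)
    Hull₃-mix {a} {b} {s} {a′} {b′} {s′} t 0≤t t≤1 (hull₃ h) (hull₃ h′) =
      hull₃ (InConv-resp-≋ coords (InConv-mix t 0≤t t≤1 h h′))
      where
      coords : (λ j → t * pt3 a b s j + (1ℚ - t) * pt3 a′ b′ s′ j) ≋
               pt3 (t * a + (1ℚ - t) * a′) (t * b + (1ℚ - t) * b′) (t * s + (1ℚ - t) * s′)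
      coords fzero = refl
      coords (fsuc fzero) = refl
      coords (fsuc (fsuc fzero)) = refl

    Hull₃-reshape : ∀ {a b s a′ b′ s′} → Hull₃ U₀ U₁ a b s → a ≡ a′ → b ≡ b′ → s ≡ s′ → Hull₃ U₀ U₁ a′ b′ s′
    Hull₃-reshape h refl refl refl = h

  -- Lattice polytopes

  Integral : ℚ → Set
  Integral p = Σ ℤ λ i → i / 1 ≡ p

  Integral² : ℚ × ℚ → Set
  Integral² (u , v) = Integral u × Integral v

  Integral-neg : ∀ {p} → Integral p → Integral (- p)
  Integral-neg (i , i/1≡p) = ℤ.- i , trans (neg/1 i) (cong -_ i/1≡p)
    where
    neg/1 : ∀ i → (ℤ.- i) / 1 ≡ - (i / 1)
    neg/1 (+ zero) = refl
    neg/1 (+ suc n) = refl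
    neg/1 (ℤ.-[1+ n ]) = sym (involutive (+ suc n / 1))
      where
      involutive : ∀ x → - (- x) ≡ x
      involutive x = solve (x ∷ []) ring

  eN-integral : ∀ {n} k (j : Fin n) → Integral (eN k j)
  eN-integral k j with toℕ j ℕ.≡ᵇ k
  ... | true = + 1 , refl
  ... | false = + 0 , refl

  lattice-polytope : ∀ {n k} {A : PSet n} (V : Fin k → Point n) → A ≐ InConv V →
                     (∀ i j → Integral (V i j)) → IsLatticePolytope A
  lattice-polytope {n} {k} V A≐V V-integral = k , Vℤ , λ x →
    (λ x∈A → InConv-resp-vertices (λ i j → sym (proj₂ (V-integral i j))) (proj₁ (A≐V x) x∈A)) ,
    (λ x∈V → proj₂ (A≐V x) (InConv-resp-vertices (λ i j → proj₂ (V-integral i j)) x∈V))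
    where
    Vℤ : Fin k → Fin n → ℤ
    Vℤ i j = proj₁ (V-integral i j)

  module Cylinder (m : ℕ) where

    a b : Point (2 ℕ.+ m) → ℚ
    a x = x fzero
    b x = x (fsuc fzero)

    z : Point (2 ℕ.+ m) → Fin m → ℚ
    z x k = x (fsuc (fsuc k))

    s : Point (2 ℕ.+ m) → ℚ
    s x = Σᶠ (z x)

    cylinder : Shadow (2 ℕ.+ m)
    cylinder = record
      { a = a ; b = b ; s = s
      ; a-affine = coord-affine fzero
      ; b-affine = coord-affine (fsuc fzero)
      ; s-affine = Σ-coords-affine (fsuc ∘ fsuc)
      }

    Cyl : List Ineq → PSet (2 ℕ.+ m)
    Cyl L x = (∀ k → 0ℚ ≤ z x k) × ⟦ L ⟧ (a x) (b x) (s x)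

    InConv-Cyl : ∀ {k} {V : Fin k → Point (2 ℕ.+ m)} {x} L → InConv V x → (∀ i → Cyl L (V i)) → Cyl L x
    InConv-Cyl L h V∈L = (λ k → InConv-nonNeg (fsuc (fsuc k)) (λ i → proj₁ (V∈L i) k) h) ,
                         InConv-⟦⟧ cylinder L h (λ i → proj₂ (V∈L i))

    Conv-Cyl : ∀ {R : PSet (2 ℕ.+ m)} {x} L → (∀ y → R y → Cyl L y) → Conv R x → Cyl L x
    Conv-Cyl L R⊆L (_ , V , V∈R , h) = InConv-Cyl L h (λ i → R⊆L (V i) (V∈R i))

    Cyl-intro : ∀ {L x u v w} → (∀ k → 0ℚ ≤ z x k) → a x ≡ u → b x ≡ v → s x ≡ w → ⟦ L ⟧ u v w → Cyl L x
    Cyl-intro z≥0 refl refl refl h = z≥0 , h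

    point : ℚ → ℚ → Point m → Point (2 ℕ.+ m)
    point u v w fzero = u
    point u v w (fsuc fzero) = v
    point u v w (fsuc (fsuc k)) = w k

    base : ℚ × ℚ → Point (2 ℕ.+ m)
    base (u , v) = point u v (λ _ → 0ℚ)

    base≋emb2 : ∀ u → base u ≋ emb2 (pt2 (proj₁ u) (proj₂ u))
    base≋emb2 u fzero = refl
    base≋emb2 u (fsuc fzero) = refl
    base≋emb2 u (fsuc (fsuc k)) = refl

    top : ℚ × ℚ → Fin m → Point (2 ℕ.+ m)
    top (u , v) k = point u v (eN (toℕ k))

    prismatoid : ∀ {K₀ K₁} → (Fin K₀ → ℚ × ℚ) → (Fin K₁ → ℚ × ℚ) → Fin (K₀ ℕ.+ K₁ ℕ.* m) → Point (2 ℕ.+ m)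
    prismatoid U₀ U₁ = (base ∘ U₀) ++ concat (λ i → top (U₁ i))

    prismatoid⁺ : ∀ {K₀ K₁} {U₀ : Fin K₀ → ℚ × ℚ} {U₁ : Fin K₁ → ℚ × ℚ} (P : Point (2 ℕ.+ m) → Set) →
                  (∀ i → P (base (U₀ i))) → (∀ i k → P (top (U₁ i) k)) → ∀ ι → P (prismatoid U₀ U₁ ι)
    prismatoid⁺ P P-base P-top = VAll.++⁺ P P-base (concat⁺ P P-top)

    base-Cyl : ∀ {L u v} → ⟦ L ⟧ u v 0ℚ → Cyl L (base (u , v))
    base-Cyl {L} {u} {v} h = (λ _ → ℚP.≤-refl) , subst (⟦ L ⟧ u v) (sym (Σᶠ-0 {m})) h

    top-Cyl : ∀ {L u v} → ⟦ L ⟧ u v 1ℚ → ∀ k → Cyl L (top (u , v) k)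
    top-Cyl {L} {u} {v} h k = eN-nonNeg (toℕ k) , subst (⟦ L ⟧ u v) (sym (Σᶠ-eN (toℕ k) (toℕ<n k))) h

    module _ {K₀ K₁} {U₀ : Fin K₀ → ℚ × ℚ} {U₁ : Fin K₁ → ℚ × ℚ} where

      Σᶠ-prismatoid : (c₀ : Fin K₀ → ℚ) (D : Fin K₁ → Fin m → ℚ) (φ : Point (2 ℕ.+ m) → ℚ) →
        Σᶠ (λ ι → (c₀ ++ concat D) ι * φ (prismatoid U₀ U₁ ι)) ≡
        Σᶠ (λ i → c₀ i * φ (base (U₀ i))) + Σᶠ {K₁} (λ i → Σᶠ {m} (λ k → D i k * φ (top (U₁ i) k)))
      Σᶠ-prismatoid c₀ D φ = trans (Σᶠ-++ C φ (base ∘ U₀) (concat (λ i → top (U₁ i))))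
        (cong₂ _+_ (Σᶠ-cong (λ i → cong (_* φ (base (U₀ i))) (lookup-++ˡ c₀ (concat D) i)))
                   (trans (Σᶠ-concat (λ ι → C (K₀ ↑ʳ ι)) φ (λ i → top (U₁ i)))
                          (Σᶠ-cong (λ i → Σᶠ-cong (λ k → cong (_* φ (top (U₁ i) k))
                            (trans (lookup-++ʳ c₀ (concat D) (combine i k)) (concat-combine D i k)))))))
        where
        C = c₀ ++ concat D

      -- The weight of a top vertex (u, 1) of the three-dimensional hull is split among the
      -- vertices (u, eₖ) in proportion zₖ / s.
      module Lifting {x} (z≥0 : ∀ k → 0ℚ ≤ z x k) (c : Fin (K₀ ℕ.+ K₁) → ℚ) (c≥0 : ∀ ι → 0ℚ ≤ c ι)
                     (coords₃ : ∀ j → Σᶠ (λ ι → c ι * prismatoid₃ U₀ U₁ ι j) ≡ pt3 (a x) (b x) (s x) j) where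

        c₀ : Fin K₀ → ℚ
        c₀ i = c (i ↑ˡ K₁)

        c₁ : Fin K₁ → ℚ
        c₁ i = c (K₀ ↑ʳ i)

        c₁≥0 : ∀ i → 0ℚ ≤ c₁ i
        c₁≥0 i = c≥0 (K₀ ↑ʳ i)

        r : ℚ
        r = recip (s x)

        D : Fin K₁ → Fin m → ℚ
        D i k = c₁ i * (z x k * r)

        C : Fin (K₀ ℕ.+ K₁ ℕ.* m) → ℚ
        C = c₀ ++ concat D

        split₃ : ∀ j → Σᶠ (λ i → c₀ i * at-level 0ℚ (U₀ i) j) + Σᶠ (λ i → c₁ i * at-level 1ℚ (U₁ i) j) ≡ pt3 (a x) (b x) (s x) j
        split₃ j = trans (sym (Σᶠ-++ c (λ y → y j) (at-level 0ℚ ∘ U₀) (at-level 1ℚ ∘ U₁))) (coords₃ j)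

        Σc₁≡s : Σᶠ c₁ ≡ s x
        Σc₁≡s = begin
          Σᶠ c₁                                            ≡⟨ sym (ℚP.+-identityˡ (Σᶠ c₁)) ⟩
          0ℚ + Σᶠ c₁                                       ≡⟨ sym (cong₂ _+_ (trans (Σᶠ-cong (λ i → ℚP.*-zeroʳ (c₀ i))) (Σᶠ-0 {K₀}))
                                                                            (Σᶠ-cong (λ i → ℚP.*-identityʳ (c₁ i)))) ⟩
          Σᶠ (λ i → c₀ i * 0ℚ) + Σᶠ (λ i → c₁ i * 1ℚ)    ≡⟨ split₃ (fsuc (fsuc fzero)) ⟩
          s x                                              ∎
          where open ≡-Reasoning

        row : ∀ i → Σᶠ (D i) ≡ c₁ i
        row i = trans (Σᶠ-*ˡ (c₁ i) (λ k → z x k * r))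
               (trans (cong (c₁ i *_) (Σᶠ-*ʳ r (z x)))
                      (*-recip-absorbs (c₁≥0 i) (subst (c₁ i ≤_) Σc₁≡s (term≤Σᶠ c₁≥0 i))))

        column : ∀ l → Σᶠ (λ i → Σᶠ (λ k → D i k * eN (toℕ k) l)) ≡ z x l
        column l = begin
          Σᶠ (λ i → Σᶠ (λ k → D i k * eN (toℕ k) l)) ≡⟨ Σᶠ-cong (λ i → Σᶠ-select′ (D i) l) ⟩
          Σᶠ (λ i → c₁ i * (z x l * r))               ≡⟨ Σᶠ-*ʳ (z x l * r) c₁ ⟩
          Σᶠ c₁ * (z x l * r)                          ≡⟨ cong (_* (z x l * r)) Σc₁≡s ⟩
          s x * (z x l * r)                            ≡⟨ regroup (s x) (z x l) r ⟩
          z x l * (s x * r)                            ≡⟨ *-recip-absorbs (z≥0 l) (term≤Σᶠ z≥0 l) ⟩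
          z x l                                        ∎
          where
          open ≡-Reasoning
          regroup : ∀ p q t → p * (q * t) ≡ q * (p * t)
          regroup p q t = solve (p ∷ q ∷ t ∷ []) ring

        C≥0 : ∀ ι → 0ℚ ≤ C ι
        C≥0 = VAll.++⁺ (0ℚ ≤_) (λ i → c≥0 (i ↑ˡ K₁))
                (concat⁺ (0ℚ ≤_) (λ i k → nonNeg-* (c₁≥0 i) (nonNeg-* (z≥0 k) (recip-nonNeg (Σᶠ-nonNeg z≥0)))))

        planar : ∀ j j₃ (π : ℚ × ℚ → ℚ) → (∀ p → base p j ≡ π p) → (∀ p k → top p k j ≡ π p) →
                 (∀ h p → at-level h p j₃ ≡ π p) →
                 Σᶠ (λ ι → C ι * prismatoid U₀ U₁ ι j) ≡ pt3 (a x) (b x) (s x) j₃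
        planar j j₃ π base≡ top≡ lift≡ = begin
          Σᶠ (λ ι → C ι * prismatoid U₀ U₁ ι j)
            ≡⟨ Σᶠ-prismatoid c₀ D (λ y → y j) ⟩
          Σᶠ (λ i → c₀ i * base (U₀ i) j) + Σᶠ (λ i → Σᶠ (λ k → D i k * top (U₁ i) k j))
            ≡⟨ cong₂ _+_ (Σᶠ-cong (λ i → cong (c₀ i *_) (base≡ (U₀ i))))
                         (Σᶠ-cong (λ i → trans (Σᶠ-cong (λ k → cong (D i k *_) (top≡ (U₁ i) k)))
                                               (trans (Σᶠ-*ʳ (π (U₁ i)) (D i)) (cong (_* π (U₁ i)) (row i))))) ⟩
          Σᶠ (λ i → c₀ i * π (U₀ i)) + Σᶠ (λ i → c₁ i * π (U₁ i))
            ≡⟨ sym (cong₂ _+_ (Σᶠ-cong (λ i → cong (c₀ i *_) (lift≡ 0ℚ (U₀ i))))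
                              (Σᶠ-cong (λ i → cong (c₁ i *_) (lift≡ 1ℚ (U₁ i))))) ⟩
          Σᶠ (λ i → c₀ i * at-level 0ℚ (U₀ i) j₃) + Σᶠ (λ i → c₁ i * at-level 1ℚ (U₁ i) j₃)
            ≡⟨ split₃ j₃ ⟩
          pt3 (a x) (b x) (s x) j₃ ∎
          where open ≡-Reasoning

        ΣC≡1 : Σᶠ c ≡ 1ℚ → Σᶠ C ≡ 1ℚ
        ΣC≡1 Σc≡1 = begin
          Σᶠ C                                                   ≡⟨ sym (Σᶠ-cong (λ ι → ℚP.*-identityʳ (C ι))) ⟩
          Σᶠ (λ ι → C ι * 1ℚ)                                    ≡⟨ Σᶠ-prismatoid c₀ D (λ _ → 1ℚ) ⟩
          Σᶠ (λ i → c₀ i * 1ℚ) + Σᶠ (λ i → Σᶠ (λ k → D i k * 1ℚ))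
            ≡⟨ cong₂ _+_ (Σᶠ-cong (λ i → ℚP.*-identityʳ (c₀ i)))
                         (Σᶠ-cong (λ i → trans (Σᶠ-cong (λ k → ℚP.*-identityʳ (D i k))) (row i))) ⟩
          Σᶠ c₀ + Σᶠ c₁                                          ≡⟨ sym (Σᶠ-↑ K₀ c) ⟩
          Σᶠ c                                                   ≡⟨ Σc≡1 ⟩
          1ℚ                                                     ∎
          where open ≡-Reasoning

        coords : ∀ j → Σᶠ (λ ι → C ι * prismatoid U₀ U₁ ι j) ≡ x j
        coords fzero = planar fzero fzero proj₁ (λ _ → refl) (λ _ _ → refl) (λ _ _ → refl)
        coords (fsuc fzero) = planar (fsuc fzero) (fsuc fzero) proj₂ (λ _ → refl) (λ _ _ → refl) (λ _ _ → refl)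
        coords (fsuc (fsuc l)) = begin
          Σᶠ (λ ι → C ι * prismatoid U₀ U₁ ι (fsuc (fsuc l)))
            ≡⟨ Σᶠ-prismatoid c₀ D (λ y → y (fsuc (fsuc l))) ⟩
          Σᶠ (λ i → c₀ i * 0ℚ) + Σᶠ (λ i → Σᶠ (λ k → D i k * eN (toℕ k) l))
            ≡⟨ cong₂ _+_ (trans (Σᶠ-cong (λ i → ℚP.*-zeroʳ (c₀ i))) (Σᶠ-0 {K₀})) (column l) ⟩
          0ℚ + z x l
            ≡⟨ ℚP.+-identityˡ (z x l) ⟩
          x (fsuc (fsuc l)) ∎
          where open ≡-Reasoning

      Hull₃-lift : ∀ {x} → (∀ k → 0ℚ ≤ z x k) → Hull₃ U₀ U₁ (a x) (b x) (s x) → InConv (prismatoid U₀ U₁) x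
      Hull₃-lift {x} z≥0 (hull₃ (c , c≥0 , Σc≡1 , coords₃)) = C , C≥0 , ΣC≡1 Σc≡1 , coords
        where open Lifting {x} z≥0 c c≥0 coords₃

      prismatoid-integral : (∀ i → Integral² (U₀ i)) → (∀ i → Integral² (U₁ i)) →
                            ∀ ι j → Integral (prismatoid U₀ U₁ ι j)
      prismatoid-integral U₀-integral U₁-integral = prismatoid⁺ (λ y → ∀ j → Integral (y j)) base-integral top-integral
        where
        base-integral : ∀ i j → Integral (base (U₀ i) j)
        base-integral i fzero = proj₁ (U₀-integral i)
        base-integral i (fsuc fzero) = proj₂ (U₀-integral i)
        base-integral i (fsuc (fsuc _)) = + 0 , refl
        top-integral : ∀ i k j → Integral (top (U₁ i) k j)
        top-integral i k fzero = proj₁ (U₁-integral i)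
        top-integral i k (fsuc fzero) = proj₂ (U₁-integral i)
        top-integral i k (fsuc (fsuc l)) = eN-integral (toℕ k) l

      prismatoid-Cyl : ∀ {L} → (∀ i → ⟦ L ⟧ (proj₁ (U₀ i)) (proj₂ (U₀ i)) 0ℚ) → (∀ i → ⟦ L ⟧ (proj₁ (U₁ i)) (proj₂ (U₁ i)) 1ℚ) →
                       ∀ ι → Cyl L (prismatoid U₀ U₁ ι)
      prismatoid-Cyl {L} U₀∈L U₁∈L = prismatoid⁺ (Cyl L) (λ i → base-Cyl (U₀∈L i)) (λ i → top-Cyl (U₁∈L i))

  -- P, Q, Tb and ip stand for p, q, q/p and 1/p. As variables subject to the relations below they are
  -- atoms for the ring solver; the sets are those of Defs with these constants substituted.
  module Construction (m : ℕ) (P Q Tb ip : ℚ)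
    (Q≡P²-P+1 : Q ≡ P * P - P + 1ℚ) (P*Tb≡Q : P * Tb ≡ Q) (P*ip≡1 : P * ip ≡ 1ℚ) (1≤P : 1ℚ ≤ P)
    (Q-integral : Integral Q) where

    open Cylinder m

    PentagonVertex : PSet 2
    PentagonVertex y =
      (y ≋ pt2 Q 0ℚ) ⊎ (y ≋ pt2 (- Q) 0ℚ)
      ⊎ (y ≋ pt2 (Q + - 1ℚ) 1ℚ) ⊎ (y ≋ pt2 (- (Q + - 1ℚ)) 1ℚ)
      ⊎ (y ≋ pt2 0ℚ Tb)

    P′ : PSet (2 ℕ.+ m)
    P′ x = Σ (Point 2) λ y → Conv PentagonVertex y × (x ≋ emb2 y)

    Pₙ : PSet (2 ℕ.+ m)
    Pₙ = Conv (P′ ∪ˢ EVerts (2 ℕ.+ m))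

    SVertex : PSet (suc m)
    SVertex y =
      (y ≋ (λ _ → 0ℚ))
      ⊎ (y ≋ (λ j → - ip * eN 0 j))
      ⊎ (Σ ℕ λ k → (1 ℕ.≤ k) × (k ℕ.< suc m) × (y ≋ eN k))

    Sₙ : PSet (suc m)
    Sₙ = Conv SVertex

    Wₙ : PSet (2 ℕ.+ m)
    Wₙ x = ((- Q) ≤ headP x) × (headP x ≤ Q) × Sₙ (tailP (λ j → x j + Q * eN 1 j))

    Hₙ : PSet (2 ℕ.+ m)
    Hₙ = Conv (Wₙ ∪ˢ Pₙ)

    -- W_n, M_n, P_n and H_n in shadow coordinates (together with z ≥ 0).
    Wsys Msys Psys Hsys : List Ineq
    Wsys = 1ℚ ·a+ 0ℚ ·b+ 0ℚ ·s≤ Q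
         ∷ - 1ℚ ·a+ 0ℚ ·b+ 0ℚ ·s≤ Q
         ∷ 0ℚ ·a+ 1ℚ ·b+ 0ℚ ·s≤ - Q
         ∷ 0ℚ ·a+ - P ·b+ 1ℚ ·s≤ P * Q + 1ℚ
         ∷ []
    Msys = 0ℚ ·a+ 0ℚ ·b+ 1ℚ ·s≤ 1ℚ
         ∷ 1ℚ ·a+ 0ℚ ·b+ 0ℚ ·s≤ Q
         ∷ - 1ℚ ·a+ 0ℚ ·b+ 0ℚ ·s≤ Q
         ∷ 0ℚ ·a+ - 1ℚ ·b+ 0ℚ ·s≤ Q
         ∷ 0ℚ ·a+ 1ℚ ·b+ 0ℚ ·s≤ 0ℚ
         ∷ 1ℚ ·a+ 1ℚ ·b+ Q ·s≤ Q
         ∷ - 1ℚ ·a+ 1ℚ ·b+ Q ·s≤ Q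
         ∷ []
    Psys = 0ℚ ·a+ - 1ℚ ·b+ 0ℚ ·s≤ 0ℚ
         ∷ 0ℚ ·a+ 0ℚ ·b+ 1ℚ ·s≤ 1ℚ
         ∷ 1ℚ ·a+ 1ℚ ·b+ Q ·s≤ Q
         ∷ - 1ℚ ·a+ 1ℚ ·b+ Q ·s≤ Q
         ∷ (P - 1ℚ) ·a+ P * P ·b+ P * Q ·s≤ P * Q
         ∷ - (P - 1ℚ) ·a+ P * P ·b+ P * Q ·s≤ P * Q
         ∷ []
    Hsys = 0ℚ ·a+ 0ℚ ·b+ 1ℚ ·s≤ 1ℚ
         ∷ 1ℚ ·a+ 0ℚ ·b+ 0ℚ ·s≤ Q
         ∷ - 1ℚ ·a+ 0ℚ ·b+ 0ℚ ·s≤ Q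
         ∷ 1ℚ ·a+ 1ℚ ·b+ Q ·s≤ Q
         ∷ - 1ℚ ·a+ 1ℚ ·b+ Q ·s≤ Q
         ∷ (P - 1ℚ) ·a+ P * P ·b+ P * Q ·s≤ P * Q
         ∷ - (P - 1ℚ) ·a+ P * P ·b+ P * Q ·s≤ P * Q
         ∷ 0ℚ ·a+ - P ·b+ 1ℚ ·s≤ P * Q + 1ℚ
         ∷ []

    0<P : 0ℚ < P
    0<P = ℚP.<-≤-trans (ℚP.positive⁻¹ 1ℚ) 1≤P

    0≤P : 0ℚ ≤ P
    0≤P = ℚP.<⇒≤ 0<P

    0≤P-1 : 0ℚ ≤ P - 1ℚ
    0≤P-1 = slack 1≤P

    0≤Q-1 : 0ℚ ≤ Q - 1ℚ
    0≤Q-1 = subst (0ℚ ≤_) (sym Q-1≡) (nonNeg-* 0≤P 0≤P-1)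
      where
      Q-1≡ : Q - 1ℚ ≡ P * (P - 1ℚ)
      Q-1≡ = trans (cong (_- 1ℚ) Q≡P²-P+1) (solve (P ∷ []) ring)

    0≤Q : 0ℚ ≤ Q
    0≤Q = ℚP.≤-trans 0≤1 (0≤q-p⇒p≤q 0≤Q-1)

    0≤Tb : 0ℚ ≤ Tb
    0≤Tb = nonNeg-cancelˡ 0<P (subst (0ℚ ≤_) (sym P*Tb≡Q) 0≤Q)

    0≤ip : 0ℚ ≤ ip
    0≤ip = nonNeg-cancelˡ 0<P (subst (0ℚ ≤_) (sym P*ip≡1) 0≤1)

    0≤0 : 0ℚ ≤ 0ℚ
    0≤0 = ℚP.≤-refl

    -- W_n ∩ M_n lies in the hyperplane b = -Q and M_n ∩ P_n in b = 0; these are their (a, s)-sections.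
    LowerFace : ℚ → ℚ → Set
    LowerFace a s = - Q ≤ a × a ≤ Q × 0ℚ ≤ s × s ≤ 1ℚ

    AxisFace : ℚ → ℚ → Set
    AxisFace a s = - (Q - Q * s) ≤ a × a ≤ Q - Q * s × 0ℚ ≤ s × s ≤ 1ℚ

    LowerFace⇒W : ∀ {a s} → LowerFace a s → ⟦ Wsys ⟧ a (- Q) s
    LowerFace⇒W {a} {s} (-Q≤a , a≤Q , _ , s≤1) =
        ≤-from (slack a≤Q) (solve (a ∷ s ∷ Q ∷ []) ring)
      ▸ ≤-from (slack -Q≤a) (solve (a ∷ s ∷ Q ∷ []) ring)
      ▸ ≤-from 0≤0 (solve (a ∷ s ∷ Q ∷ []) ring)
      ▸ ≤-from (slack s≤1) (solve (a ∷ s ∷ P ∷ Q ∷ []) ring)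
      ▸ []

    LowerFace⇒M : ∀ {a s} → LowerFace a s → ⟦ Msys ⟧ a (- Q) s
    LowerFace⇒M {a} {s} (-Q≤a , a≤Q , _ , s≤1) =
        ≤-from (slack s≤1) (solve (a ∷ s ∷ Q ∷ []) ring)
      ▸ ≤-from (slack a≤Q) (solve (a ∷ s ∷ Q ∷ []) ring)
      ▸ ≤-from (slack -Q≤a) (solve (a ∷ s ∷ Q ∷ []) ring)
      ▸ ≤-from 0≤0 (solve (a ∷ s ∷ Q ∷ []) ring)
      ▸ ≤-from 0≤Q (solve (a ∷ s ∷ Q ∷ []) ring)
      ▸ ≤-from (nonNeg-+ (slack a≤Q) (nonNeg-* 0≤Q (slack s≤1))) (solve (a ∷ s ∷ Q ∷ []) ring)
      ▸ ≤-from (nonNeg-+ (slack -Q≤a) (nonNeg-* 0≤Q (slack s≤1))) (solve (a ∷ s ∷ Q ∷ []) ring)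
      ▸ []

    AxisFace⇒M : ∀ {a s} → AxisFace a s → ⟦ Msys ⟧ a 0ℚ s
    AxisFace⇒M {a} {s} (lower , upper , 0≤s , s≤1) =
        ≤-from (slack s≤1) (solve (a ∷ s ∷ Q ∷ []) ring)
      ▸ ≤-from (nonNeg-+ (slack upper) (nonNeg-* 0≤Q 0≤s)) (solve (a ∷ s ∷ Q ∷ []) ring)
      ▸ ≤-from (nonNeg-+ (slack lower) (nonNeg-* 0≤Q 0≤s)) (solve (a ∷ s ∷ Q ∷ []) ring)
      ▸ ≤-from 0≤Q (solve (a ∷ s ∷ Q ∷ []) ring)
      ▸ ≤-from 0≤0 (solve (a ∷ s ∷ Q ∷ []) ring)
      ▸ ≤-from (slack upper) (solve (a ∷ s ∷ Q ∷ []) ring)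
      ▸ ≤-from (slack lower) (solve (a ∷ s ∷ Q ∷ []) ring)
      ▸ []

    AxisFace⇒P : ∀ {a s} → AxisFace a s → ⟦ Psys ⟧ a 0ℚ s
    AxisFace⇒P {a} {s} (lower , upper , 0≤s , s≤1) =
        ≤-from 0≤0 (solve (a ∷ s ∷ Q ∷ []) ring)
      ▸ ≤-from (slack s≤1) (solve (a ∷ s ∷ Q ∷ []) ring)
      ▸ ≤-from (slack upper) (solve (a ∷ s ∷ Q ∷ []) ring)
      ▸ ≤-from (slack lower) (solve (a ∷ s ∷ Q ∷ []) ring)
      ▸ ≤-from (nonNeg-+ (nonNeg-* 0≤P-1 (slack upper)) (nonNeg-* 0≤Q (slack s≤1))) (solve (a ∷ s ∷ P ∷ Q ∷ []) ring)
      ▸ ≤-from (nonNeg-+ (nonNeg-* 0≤P-1 (slack lower)) (nonNeg-* 0≤Q (slack s≤1))) (solve (a ∷ s ∷ P ∷ Q ∷ []) ring)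
      ▸ []

    WM⇒LowerFace : ∀ {a b s} → 0ℚ ≤ s → ⟦ Wsys ⟧ a b s → ⟦ Msys ⟧ a b s → b ≡ - Q × LowerFace a s
    WM⇒LowerFace {a} {b} {s} 0≤s (w₁ ▸ w₂ ▸ w₃ ▸ _) (m₁ ▸ _ ▸ _ ▸ m₄ ▸ _) =
      ℚP.≤-antisym (≤-from (slack w₃) (solve (a ∷ b ∷ s ∷ Q ∷ []) ring)) (≤-from (slack m₄) (solve (a ∷ b ∷ s ∷ Q ∷ []) ring)) ,
      ≤-from (slack w₂) (solve (a ∷ b ∷ s ∷ Q ∷ []) ring) ,
      ≤-from (slack w₁) (solve (a ∷ b ∷ s ∷ Q ∷ []) ring) ,
      0≤s ,
      ≤-from (slack m₁) (solve (a ∷ b ∷ s ∷ []) ring)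

    MP⇒AxisFace : ∀ {a b s} → 0ℚ ≤ s → ⟦ Msys ⟧ a b s → ⟦ Psys ⟧ a b s → b ≡ 0ℚ × AxisFace a s
    MP⇒AxisFace {a} {b} {s} 0≤s (m₁ ▸ _ ▸ _ ▸ _ ▸ m₅ ▸ m₆ ▸ m₇ ▸ []) (p₁ ▸ _) =
      ℚP.≤-antisym (≤-from (slack m₅) (solve (a ∷ b ∷ s ∷ []) ring)) (≤-from (slack p₁) (solve (a ∷ b ∷ s ∷ []) ring)) ,
      ≤-from (nonNeg-+ (slack m₇) (slack p₁)) (solve (a ∷ b ∷ s ∷ Q ∷ []) ring) ,
      ≤-from (nonNeg-+ (slack m₆) (slack p₁)) (solve (a ∷ b ∷ s ∷ Q ∷ []) ring) ,
      0≤s ,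
      ≤-from (slack m₁) (solve (a ∷ b ∷ s ∷ []) ring)

    lowerRight lowerLeft right left origin : ℚ × ℚ
    lowerRight = Q , - Q
    lowerLeft = - Q , - Q
    right = Q , 0ℚ
    left = - Q , 0ℚ
    origin = 0ℚ , 0ℚ

    lowerEdge : Fin 2 → ℚ × ℚ
    lowerEdge = lookup (lowerRight ∷ lowerLeft ∷ [])

    Mbase : Fin 4 → ℚ × ℚ
    Mbase = lookup (lowerRight ∷ lowerLeft ∷ right ∷ left ∷ [])

    Mtop : Fin 3 → ℚ × ℚ
    Mtop = lookup (lowerRight ∷ lowerLeft ∷ origin ∷ [])

    axisEdge : Fin 2 → ℚ × ℚ
    axisEdge = lookup (right ∷ left ∷ [])

    upperRight upperLeft apex : ℚ × ℚ
    upperRight = Q + - 1ℚ , 1ℚ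
    upperLeft = - (Q + - 1ℚ) , 1ℚ
    apex = 0ℚ , Tb

    pentagon : Fin 5 → ℚ × ℚ
    pentagon = lookup (right ∷ left ∷ upperRight ∷ upperLeft ∷ apex ∷ [])

    originOnly : Fin 1 → ℚ × ℚ
    originOnly = lookup (origin ∷ [])

    LowerFace-hull : ∀ {a s} → LowerFace a s → Hull₃ lowerEdge lowerEdge a (- Q) s
    LowerFace-hull {a} {s} (-Q≤a , a≤Q , 0≤s , s≤1) = assemble (interval-point -Q≤a a≤Q)
      where
      open Hull₃-Properties lowerEdge lowerEdge
      assemble : OnSegment (- Q) Q a → Hull₃ lowerEdge lowerEdge a (- Q) s
      assemble (t , 0≤t , t≤1 , a≡) =
        Hull₃-reshape (Hull₃-mix s 0≤s s≤1 edge₁ edge₀)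
          (trans-sym a≡ (solve (s ∷ t ∷ Q ∷ []) ring)) (solve (s ∷ t ∷ Q ∷ []) ring) (solve (s ∷ t ∷ Q ∷ []) ring)
        where
        edge₀ : Hull₃ lowerEdge lowerEdge (t * Q + (1ℚ - t) * - Q) (t * - Q + (1ℚ - t) * - Q) (t * 0ℚ + (1ℚ - t) * 0ℚ)
        edge₀ = Hull₃-mix t 0≤t t≤1 (Hull₃-base (# 0) refl) (Hull₃-base (# 1) refl)
        edge₁ : Hull₃ lowerEdge lowerEdge (t * Q + (1ℚ - t) * - Q) (t * - Q + (1ℚ - t) * - Q) (t * 1ℚ + (1ℚ - t) * 1ℚ)
        edge₁ = Hull₃-mix t 0≤t t≤1 (Hull₃-top (# 0) refl) (Hull₃-top (# 1) refl)

    AxisFace-hull : ∀ {a s} → AxisFace a s → Hull₃ axisEdge originOnly a 0ℚ s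
    AxisFace-hull {a} {s} (lower , upper , 0≤s , s≤1) = assemble (interval-point lower upper)
      where
      open Hull₃-Properties axisEdge originOnly
      assemble : OnSegment (- (Q - Q * s)) (Q - Q * s) a → Hull₃ axisEdge originOnly a 0ℚ s
      assemble (t , 0≤t , t≤1 , a≡) =
        Hull₃-reshape (Hull₃-mix s 0≤s s≤1 (Hull₃-top (# 0) refl) axis)
          (trans-sym a≡ (solve (s ∷ t ∷ Q ∷ []) ring)) (solve (s ∷ t ∷ Q ∷ []) ring) (solve (s ∷ t ∷ Q ∷ []) ring)
        where
        axis : Hull₃ axisEdge originOnly (t * Q + (1ℚ - t) * - Q) (t * 0ℚ + (1ℚ - t) * 0ℚ) (t * 0ℚ + (1ℚ - t) * 0ℚ)
        axis = Hull₃-mix t 0≤t t≤1 (Hull₃-base (# 0) refl) (Hull₃-base (# 1) refl)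

    -- Below b = -sQ the point is a combination of the two lower edges and the axis edge; above it, of
    -- the axis edge and the top triangle.
    M-hull : ∀ {a b s} → 0ℚ ≤ s → ⟦ Msys ⟧ a b s → Hull₃ Mbase Mtop a b s
    M-hull {a} {b} {s} 0≤s (m₁ ▸ m₂ ▸ m₃ ▸ m₄ ▸ m₅ ▸ m₆ ▸ m₇ ▸ []) = [ deep , shallow ]′ (ℚP.≤-total b (- (s * Q)))
      where
      open Hull₃-Properties Mbase Mtop
      s≤1 : s ≤ 1ℚ
      s≤1 = ≤-from (slack m₁) (solve (a ∷ b ∷ s ∷ []) ring)
      -Q≤a : - Q ≤ a
      -Q≤a = ≤-from (slack m₃) (solve (a ∷ b ∷ s ∷ Q ∷ []) ring)
      a≤Q : a ≤ Q
      a≤Q = ≤-from (slack m₂) (solve (a ∷ b ∷ s ∷ Q ∷ []) ring)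
      -Q≤b : - Q ≤ b
      -Q≤b = ≤-from (slack m₄) (solve (a ∷ b ∷ s ∷ Q ∷ []) ring)
      b≤0 : b ≤ 0ℚ
      b≤0 = ≤-from (slack m₅) (solve (a ∷ b ∷ s ∷ []) ring)
      a≤width : a ≤ Q - b - Q * s
      a≤width = ≤-from (slack m₆) (solve (a ∷ b ∷ s ∷ Q ∷ []) ring)
      -width≤a : - (Q - b - Q * s) ≤ a
      -width≤a = ≤-from (slack m₇) (solve (a ∷ b ∷ s ∷ Q ∷ []) ring)
      lower₀ : ∀ {t} → 0ℚ ≤ t → t ≤ 1ℚ → Hull₃ Mbase Mtop (t * Q + (1ℚ - t) * - Q) (t * - Q + (1ℚ - t) * - Q) (t * 0ℚ + (1ℚ - t) * 0ℚ)
      lower₀ {t} 0≤t t≤1 = Hull₃-mix t 0≤t t≤1 (Hull₃-base (# 0) refl) (Hull₃-base (# 1) refl)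
      lower₁ : ∀ {t} → 0ℚ ≤ t → t ≤ 1ℚ → Hull₃ Mbase Mtop (t * Q + (1ℚ - t) * - Q) (t * - Q + (1ℚ - t) * - Q) (t * 1ℚ + (1ℚ - t) * 1ℚ)
      lower₁ {t} 0≤t t≤1 = Hull₃-mix t 0≤t t≤1 (Hull₃-top (# 0) refl) (Hull₃-top (# 1) refl)
      axis : ∀ {t} → 0ℚ ≤ t → t ≤ 1ℚ → Hull₃ Mbase Mtop (t * Q + (1ℚ - t) * - Q) (t * 0ℚ + (1ℚ - t) * 0ℚ) (t * 0ℚ + (1ℚ - t) * 0ℚ)
      axis {t} 0≤t t≤1 = Hull₃-mix t 0≤t t≤1 (Hull₃-base (# 2) refl) (Hull₃-base (# 3) refl)
      deep : b ≤ - (s * Q) → Hull₃ Mbase Mtop a b s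
      deep b≤-sQ = assemble (interval-point -Q≤b b≤-sQ) (interval-point -Q≤a a≤Q)
        where
        assemble : OnSegment (- Q) (- (s * Q)) b → OnSegment (- Q) Q a → Hull₃ Mbase Mtop a b s
        assemble (μ , 0≤μ , μ≤1 , b≡) (t , 0≤t , t≤1 , a≡) =
          Hull₃-reshape (Hull₃-mix s 0≤s s≤1 (lower₁ 0≤t t≤1) (Hull₃-mix μ 0≤μ μ≤1 (axis 0≤t t≤1) (lower₀ 0≤t t≤1)))
            (trans-sym a≡ (solve (s ∷ t ∷ μ ∷ Q ∷ []) ring)) (trans-sym b≡ (solve (s ∷ t ∷ μ ∷ Q ∷ []) ring))
            (solve (s ∷ t ∷ μ ∷ Q ∷ []) ring)
      shallow : - (s * Q) ≤ b → Hull₃ Mbase Mtop a b s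
      shallow -sQ≤b = assemble (interval-point -sQ≤b b≤0) (interval-point -width≤a a≤width)
        where
        assemble : OnSegment (- (s * Q)) 0ℚ b → OnSegment (- (Q - b - Q * s)) (Q - b - Q * s) a → Hull₃ Mbase Mtop a b s
        assemble (ρ , 0≤ρ , ρ≤1 , b≡) (t , 0≤t , t≤1 , a≡) =
          Hull₃-reshape (Hull₃-mix s 0≤s s≤1 (Hull₃-mix ρ 0≤ρ ρ≤1 (Hull₃-top (# 2) refl) (lower₁ 0≤t t≤1)) (axis 0≤t t≤1))
            (trans-sym (trans a≡ (cong (λ β → (1ℚ - t) * - (Q - β - Q * s) + t * (Q - β - Q * s)) b≡))
                       (solve (s ∷ t ∷ ρ ∷ Q ∷ []) ring))
            (trans-sym b≡ (solve (s ∷ t ∷ ρ ∷ Q ∷ []) ring))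
            (solve (s ∷ t ∷ ρ ∷ Q ∷ []) ring)

    Q-relation : Q - (P * P - P + 1ℚ) ≡ 0ℚ
    Q-relation = trans (cong (_- (P * P - P + 1ℚ)) Q≡P²-P+1) (ℚP.+-inverseʳ (P * P - P + 1ℚ))

    Tb-relation : P * Tb - Q ≡ 0ℚ
    Tb-relation = trans (cong (_- Q) P*Tb≡Q) (ℚP.+-inverseʳ Q)

    modulo-relations : ∀ {x y} c₁ c₂ → x ≡ y + c₁ * (Q - (P * P - P + 1ℚ)) + c₂ * (P * Tb - Q) → x ≡ y
    modulo-relations {x} {y} c₁ c₂ x≡ =
      trans x≡ (trans (cong₂ (λ e₁ e₂ → y + c₁ * e₁ + c₂ * e₂) Q-relation Tb-relation) (solve (y ∷ c₁ ∷ c₂ ∷ []) ring))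

    -- For P = 1 the slanted facets are parallel to the a-axis; then Tb = Q and the edge facet suffices.
    apex-bound : ∀ {α b s ρ} → α + b + Q * s ≤ Q → (P - 1ℚ) * α + P * P * b + P * Q * s ≤ P * Q →
                 b ≡ (1ℚ - ρ) * (1ℚ - s) + ρ * ((1ℚ - s) * Tb) → α ≤ (Q - 1ℚ) * (1ℚ - s) * (1ℚ - ρ)
    apex-bound {α} {b} {s} {ρ} edge slant b≡ = by-cases (ℚP.<-cmp 1ℚ P)
      where
      by-cases : Tri (1ℚ < P) (1ℚ ≡ P) (P < 1ℚ) → α ≤ (Q - 1ℚ) * (1ℚ - s) * (1ℚ - ρ)
      by-cases (tri> _ _ P<1) = ⊥-elim (ℚP.<-irrefl refl (ℚP.<-≤-trans P<1 1≤P))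
      by-cases (tri≈ _ 1≡P _) = ≤-from (slack edge′) (solve (α ∷ s ∷ ρ ∷ Q ∷ []) ring)
        where
        Tb≡Q : Tb ≡ Q
        Tb≡Q = trans (sym (ℚP.*-identityˡ Tb)) (trans (cong (_* Tb) 1≡P) P*Tb≡Q)
        edge′ : α + ((1ℚ - ρ) * (1ℚ - s) + ρ * ((1ℚ - s) * Q)) + Q * s ≤ Q
        edge′ = subst (λ τ → α + ((1ℚ - ρ) * (1ℚ - s) + ρ * ((1ℚ - s) * τ)) + Q * s ≤ Q) Tb≡Q
                      (subst (λ β → α + β + Q * s ≤ Q) b≡ edge)
      by-cases (tri< 1<P _ _) = 0≤q-p⇒p≤q (nonNeg-cancelˡ 0<P-1 (subst (0ℚ ≤_) (sym scaled) (slack slant′)))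
        where
        0<P-1 : 0ℚ < P - 1ℚ
        0<P-1 = subst (_< P - 1ℚ) (ℚP.+-inverseʳ 1ℚ) (ℚP.+-monoˡ-< (- 1ℚ) 1<P)
        slant′ : (P - 1ℚ) * α + P * P * ((1ℚ - ρ) * (1ℚ - s) + ρ * ((1ℚ - s) * Tb)) + P * Q * s ≤ P * Q
        slant′ = subst (λ β → (P - 1ℚ) * α + P * P * β + P * Q * s ≤ P * Q) b≡ slant
        scaled : (P - 1ℚ) * ((Q - 1ℚ) * (1ℚ - s) * (1ℚ - ρ) - α) ≡
                 P * Q - ((P - 1ℚ) * α + P * P * ((1ℚ - ρ) * (1ℚ - s) + ρ * ((1ℚ - s) * Tb)) + P * Q * s)
        scaled = modulo-relations (- ((1ℚ - s) * (1ℚ - ρ))) ((1ℚ - s) * (P * ρ)) (solve (α ∷ s ∷ ρ ∷ P ∷ Q ∷ Tb ∷ []) ring)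

    pentagon-upper-edge : ∀ {t} → 0ℚ ≤ t → t ≤ 1ℚ →
      Hull₃ pentagon originOnly (t * (Q + - 1ℚ) + (1ℚ - t) * - (Q + - 1ℚ)) (t * 1ℚ + (1ℚ - t) * 1ℚ) (t * 0ℚ + (1ℚ - t) * 0ℚ)
    pentagon-upper-edge {t} 0≤t t≤1 = Hull₃-mix t 0≤t t≤1 (Hull₃-base (# 2) refl) (Hull₃-base (# 3) refl)
      where open Hull₃-Properties pentagon originOnly

    below-upper-edge : ∀ {a b s} → 0ℚ ≤ s → s ≤ 1ℚ → OnSegment 0ℚ (1ℚ - s) b →
                       OnSegment (- (Q - b - Q * s)) (Q - b - Q * s) a → Hull₃ pentagon originOnly a b s
    below-upper-edge {a} {b} {s} 0≤s s≤1 (μ , 0≤μ , μ≤1 , b≡) (t , 0≤t , t≤1 , a≡) =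
      Hull₃-reshape (Hull₃-mix s 0≤s s≤1 (Hull₃-top (# 0) refl) (Hull₃-mix μ 0≤μ μ≤1 (pentagon-upper-edge 0≤t t≤1) axis))
        (trans-sym (trans a≡ (cong (λ β → (1ℚ - t) * - (Q - β - Q * s) + t * (Q - β - Q * s)) b≡))
                   (solve (s ∷ t ∷ μ ∷ Q ∷ []) ring))
        (trans-sym b≡ (solve (s ∷ t ∷ μ ∷ Q ∷ []) ring))
        (solve (s ∷ t ∷ μ ∷ Q ∷ []) ring)
      where
      open Hull₃-Properties pentagon originOnly
      axis : Hull₃ pentagon originOnly (t * Q + (1ℚ - t) * - Q) (t * 0ℚ + (1ℚ - t) * 0ℚ) (t * 0ℚ + (1ℚ - t) * 0ℚ)
      axis = Hull₃-mix t 0≤t t≤1 (Hull₃-base (# 0) refl) (Hull₃-base (# 1) refl)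

    apex-height : ∀ {a b s} → ⟦ Psys ⟧ a b s → b ≤ (1ℚ - s) * Tb
    apex-height {a} {b} {s} (_ ▸ _ ▸ _ ▸ _ ▸ p₅ ▸ p₆ ▸ []) =
      0≤q-p⇒p≤q (nonNeg-cancelˡ 0<P (nonNeg-cancelˡ 0<P (subst (0ℚ ≤_) (sym scaled) average)))
      where
      0≤½ : 0ℚ ≤ ½
      0≤½ = ℚP.<⇒≤ (ℚP.positive⁻¹ ½)
      average : 0ℚ ≤ ½ * (P * Q - ((P - 1ℚ) * a + P * P * b + P * Q * s)) + ½ * (P * Q - (- (P - 1ℚ) * a + P * P * b + P * Q * s))
      average = nonNeg-+ (nonNeg-* 0≤½ (slack p₅)) (nonNeg-* 0≤½ (slack p₆))
      scaled : P * (P * ((1ℚ - s) * Tb - b)) ≡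
               ½ * (P * Q - ((P - 1ℚ) * a + P * P * b + P * Q * s)) + ½ * (P * Q - (- (P - 1ℚ) * a + P * P * b + P * Q * s))
      scaled = modulo-relations 0ℚ (P * (1ℚ - s)) (solve (a ∷ b ∷ s ∷ P ∷ Q ∷ Tb ∷ []) ring)

    below-apex : ∀ {a b s} → 0ℚ ≤ s → s ≤ 1ℚ → ⟦ Psys ⟧ a b s → OnSegment (1ℚ - s) ((1ℚ - s) * Tb) b →
                 Hull₃ pentagon originOnly a b s
    below-apex {a} {b} {s} 0≤s s≤1 (_ ▸ _ ▸ p₃ ▸ p₄ ▸ p₅ ▸ p₆ ▸ []) (ρ , 0≤ρ , ρ≤1 , b≡) = assemble (interval-point -K≤a a≤K)
      where
      open Hull₃-Properties pentagon originOnly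
      a≤K : a ≤ (Q - 1ℚ) * (1ℚ - s) * (1ℚ - ρ)
      a≤K = apex-bound {a} {b} {s} {ρ} (≤-from (slack p₃) (solve (a ∷ b ∷ s ∷ Q ∷ []) ring))
                                       (≤-from (slack p₅) (solve (a ∷ b ∷ s ∷ P ∷ Q ∷ []) ring)) b≡
      -a≤K : - a ≤ (Q - 1ℚ) * (1ℚ - s) * (1ℚ - ρ)
      -a≤K = apex-bound { - a} {b} {s} {ρ} (≤-from (slack p₄) (solve (a ∷ b ∷ s ∷ Q ∷ []) ring))
                                          (≤-from (slack p₆) (solve (a ∷ b ∷ s ∷ P ∷ Q ∷ []) ring)) b≡
      -K≤a : - ((Q - 1ℚ) * (1ℚ - s) * (1ℚ - ρ)) ≤ a
      -K≤a = ≤-from (slack -a≤K) (solve (a ∷ s ∷ ρ ∷ Q ∷ []) ring)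
      assemble : OnSegment (- ((Q - 1ℚ) * (1ℚ - s) * (1ℚ - ρ))) ((Q - 1ℚ) * (1ℚ - s) * (1ℚ - ρ)) a →
                 Hull₃ pentagon originOnly a b s
      assemble (t , 0≤t , t≤1 , a≡) =
        Hull₃-reshape (Hull₃-mix s 0≤s s≤1 (Hull₃-top (# 0) refl) (Hull₃-mix ρ 0≤ρ ρ≤1 (Hull₃-base (# 4) refl) (pentagon-upper-edge 0≤t t≤1)))
          (trans-sym a≡ (solve (s ∷ t ∷ ρ ∷ Q ∷ []) ring))
          (trans-sym b≡ (solve (s ∷ t ∷ ρ ∷ Q ∷ Tb ∷ []) ring))
          (solve (s ∷ t ∷ ρ ∷ Q ∷ []) ring)

    P-hull : ∀ {a b s} → 0ℚ ≤ s → ⟦ Psys ⟧ a b s → Hull₃ pentagon originOnly a b s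
    P-hull {a} {b} {s} 0≤s h@(p₁ ▸ p₂ ▸ p₃ ▸ p₄ ▸ _) = [ low , high ]′ (ℚP.≤-total b (1ℚ - s))
      where
      s≤1 : s ≤ 1ℚ
      s≤1 = ≤-from (slack p₂) (solve (a ∷ b ∷ s ∷ []) ring)
      0≤b : 0ℚ ≤ b
      0≤b = ≤-from (slack p₁) (solve (a ∷ b ∷ s ∷ []) ring)
      a≤width : a ≤ Q - b - Q * s
      a≤width = ≤-from (slack p₃) (solve (a ∷ b ∷ s ∷ Q ∷ []) ring)
      -width≤a : - (Q - b - Q * s) ≤ a
      -width≤a = ≤-from (slack p₄) (solve (a ∷ b ∷ s ∷ Q ∷ []) ring)
      low : b ≤ 1ℚ - s → Hull₃ pentagon originOnly a b s
      low b≤1-s = below-upper-edge 0≤s s≤1 (interval-point 0≤b b≤1-s) (interval-point -width≤a a≤width)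
      high : 1ℚ - s ≤ b → Hull₃ pentagon originOnly a b s
      high 1-s≤b = below-apex 0≤s s≤1 h (interval-point 1-s≤b (apex-height h))

    -- For y the tail of x + Q e₂, as in the definition of W_n, this shadow of y is (0, b + Q, s).
    simplex-shadow : Shadow (suc m)
    simplex-shadow = record
      { a = λ _ → 0ℚ ; b = λ y → y fzero ; s = λ y → Σᶠ (λ k → y (fsuc k))
      ; a-affine = zero-affine ; b-affine = coord-affine fzero ; s-affine = Σ-coords-affine fsuc }

    Ssys : List Ineq
    Ssys = 0ℚ ·a+ 1ℚ ·b+ 0ℚ ·s≤ 0ℚ
         ∷ 0ℚ ·a+ - P ·b+ 1ℚ ·s≤ 1ℚ
         ∷ []

    SVertex⇒S : ∀ y → SVertex y → ⟦ Ssys ⟧ 0ℚ (y fzero) (Σᶠ (λ k → y (fsuc k)))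
    SVertex⇒S y (inj₁ y≋0) =
      subst₂ (⟦ Ssys ⟧ 0ℚ) (sym (y≋0 fzero)) (sym (trans (Σᶠ-cong (λ k → y≋0 (fsuc k))) (Σᶠ-0 {m})))
        (≤-from 0≤0 (solve (P ∷ []) ring) ▸ ≤-from 0≤1 (solve (P ∷ []) ring) ▸ [])
    SVertex⇒S y (inj₂ (inj₁ y≋-ip)) =
      subst₂ (⟦ Ssys ⟧ 0ℚ) (sym (y≋-ip fzero))
             (sym (trans (Σᶠ-cong (λ k → trans (y≋-ip (fsuc k)) (ℚP.*-zeroʳ (- ip)))) (Σᶠ-0 {m})))
        (≤-from 0≤ip (solve (ip ∷ []) ring) ▸ ≤-from 0≤0 P*ip-slack ▸ [])
      where
      P*ip-slack : 1ℚ - (0ℚ * 0ℚ + - P * (- ip * 1ℚ) + 1ℚ * 0ℚ) ≡ 0ℚ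
      P*ip-slack = begin
        1ℚ - (0ℚ * 0ℚ + - P * (- ip * 1ℚ) + 1ℚ * 0ℚ) ≡⟨ solve (P ∷ ip ∷ []) ring ⟩
        1ℚ - P * ip                                  ≡⟨ cong (λ p → 1ℚ - p) P*ip≡1 ⟩
        1ℚ - 1ℚ                                      ≡⟨ ℚP.+-inverseʳ 1ℚ ⟩
        0ℚ                                           ∎
        where open ≡-Reasoning
    SVertex⇒S y (inj₂ (inj₂ (suc k , _ , s≤s k<m , y≋eN))) =
      subst₂ (⟦ Ssys ⟧ 0ℚ) (sym (y≋eN fzero)) (sym (trans (Σᶠ-cong (λ j → y≋eN (fsuc j))) (Σᶠ-eN k k<m)))
        (≤-from 0≤0 (solve (P ∷ []) ring) ▸ ≤-from 0≤0 (solve (P ∷ []) ring) ▸ [])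

    SVertex-nonNeg : ∀ k y → SVertex y → 0ℚ ≤ y (fsuc k)
    SVertex-nonNeg k y (inj₁ y≋0) = subst (0ℚ ≤_) (sym (y≋0 (fsuc k))) 0≤0
    SVertex-nonNeg k y (inj₂ (inj₁ y≋-ip)) = subst (0ℚ ≤_) (sym (trans (y≋-ip (fsuc k)) (ℚP.*-zeroʳ (- ip)))) 0≤0
    SVertex-nonNeg k y (inj₂ (inj₂ (j , _ , _ , y≋eN))) = subst (0ℚ ≤_) (sym (y≋eN (fsuc k))) (eN-nonNeg j (fsuc k))

    S⇒W : ∀ {a b σ} → - Q ≤ a → a ≤ Q → ⟦ Ssys ⟧ 0ℚ (b + Q * 1ℚ) σ → ⟦ Wsys ⟧ a b σ
    S⇒W {a} {b} {σ} -Q≤a a≤Q (s₁ ▸ s₂ ▸ []) =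
        ≤-from (slack a≤Q) (solve (a ∷ b ∷ σ ∷ Q ∷ []) ring)
      ▸ ≤-from (slack -Q≤a) (solve (a ∷ b ∷ σ ∷ Q ∷ []) ring)
      ▸ ≤-from (slack s₁) (solve (a ∷ b ∷ σ ∷ Q ∷ []) ring)
      ▸ ≤-from (slack s₂) (solve (a ∷ b ∷ σ ∷ P ∷ Q ∷ []) ring)
      ▸ []

    Wₙ⇒W : ∀ x → Wₙ x → Cyl Wsys x
    Wₙ⇒W x (-Q≤a , a≤Q , y∈S) = z≥0 , subst (⟦ Wsys ⟧ (a x) (b x)) shifted-sum (S⇒W -Q≤a a≤Q S-holds)
      where
      shift : ∀ k → z x k + Q * 0ℚ ≡ z x k
      shift k = trans (cong (λ q → z x k + q) (ℚP.*-zeroʳ Q)) (ℚP.+-identityʳ (z x k))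
      shifted-sum : Σᶠ (λ k → z x k + Q * 0ℚ) ≡ s x
      shifted-sum = Σᶠ-cong shift
      S-holds : ⟦ Ssys ⟧ 0ℚ (b x + Q * 1ℚ) (Σᶠ (λ k → z x k + Q * 0ℚ))
      S-holds = Conv-⟦⟧ simplex-shadow Ssys SVertex⇒S y∈S
      z≥0 : ∀ k → 0ℚ ≤ z x k
      z≥0 k = subst (0ℚ ≤_) (shift k) (Conv-nonNeg (fsuc k) (SVertex-nonNeg k) y∈S)

    W-bounds : ∀ {a b s} → ⟦ Wsys ⟧ a b s →
               (- Q ≤ a) × (a ≤ Q) × (0ℚ ≤ 1ℚ + P * (b + Q) - s) × (0ℚ ≤ - (P * (b + Q)))
    W-bounds {a} {b} {s} (w₁ ▸ w₂ ▸ w₃ ▸ w₄ ▸ []) =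
      ≤-from (slack w₂) (solve (a ∷ b ∷ s ∷ Q ∷ []) ring) ,
      ≤-from (slack w₁) (solve (a ∷ b ∷ s ∷ Q ∷ []) ring) ,
      ≤-from (slack w₄) (solve (a ∷ b ∷ s ∷ P ∷ Q ∷ []) ring) ,
      ≤-from (nonNeg-* 0≤P (slack w₃)) (solve (a ∷ b ∷ s ∷ P ∷ Q ∷ []) ring)

    simplex-corner : Fin (2 ℕ.+ m) → Point (suc m)
    simplex-corner fzero = λ _ → 0ℚ
    simplex-corner (fsuc fzero) = λ j → - ip * eN 0 j
    simplex-corner (fsuc (fsuc k)) = eN (suc (toℕ k))

    simplex-corner∈S : ∀ i → SVertex (simplex-corner i)
    simplex-corner∈S fzero = inj₁ (λ _ → refl)
    simplex-corner∈S (fsuc fzero) = inj₂ (inj₁ (λ _ → refl))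
    simplex-corner∈S (fsuc (fsuc k)) = inj₂ (inj₂ (suc (toℕ k) , s≤s z≤n , s≤s (toℕ<n k) , λ _ → refl))

    barycentric : Point (2 ℕ.+ m) → Fin (2 ℕ.+ m) → ℚ
    barycentric x fzero = 1ℚ + P * (b x + Q) - s x
    barycentric x (fsuc fzero) = - (P * (b x + Q))
    barycentric x (fsuc (fsuc k)) = z x k

    barycentric-coords : ∀ x j →
      Σᶠ (λ i → barycentric x i * simplex-corner i j) ≡ tailP (λ j → x j + Q * eN 1 j) j
    barycentric-coords x fzero = begin
      c₀ * 0ℚ + (c₁ * (- ip * 1ℚ) + Σᶠ (λ k → z x k * 0ℚ))
        ≡⟨ cong (λ t → c₀ * 0ℚ + (c₁ * (- ip * 1ℚ) + t)) (trans (Σᶠ-cong (λ k → ℚP.*-zeroʳ (z x k))) (Σᶠ-0 {m})) ⟩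
      c₀ * 0ℚ + (c₁ * (- ip * 1ℚ) + 0ℚ) ≡⟨ factor (b x) (s x) ⟩
      (P * ip) * (b x + Q)               ≡⟨ cong (_* (b x + Q)) P*ip≡1 ⟩
      1ℚ * (b x + Q)                     ≡⟨ unit (b x) ⟩
      b x + Q * 1ℚ                       ∎
      where
      open ≡-Reasoning
      c₀ c₁ : ℚ
      c₀ = barycentric x fzero
      c₁ = barycentric x (fsuc fzero)
      factor : ∀ b s → (1ℚ + P * (b + Q) - s) * 0ℚ + (- (P * (b + Q)) * (- ip * 1ℚ) + 0ℚ) ≡ (P * ip) * (b + Q)
      factor b s = solve (b ∷ s ∷ P ∷ Q ∷ ip ∷ []) ring
      unit : ∀ b → 1ℚ * (b + Q) ≡ b + Q * 1ℚ
      unit b = solve (b ∷ Q ∷ []) ring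
    barycentric-coords x (fsuc l) =
      trans (cong (λ t → barycentric x fzero * 0ℚ + (barycentric x (fsuc fzero) * (- ip * 0ℚ) + t)) (Σᶠ-select′ (z x) l))
            (drop-zeros (barycentric x fzero) (barycentric x (fsuc fzero)) (z x l))
      where
      drop-zeros : ∀ c₀ c₁ t → c₀ * 0ℚ + (c₁ * (- ip * 0ℚ) + t) ≡ t + Q * 0ℚ
      drop-zeros c₀ c₁ t = solve (c₀ ∷ c₁ ∷ t ∷ ip ∷ Q ∷ []) ring

    W⇒Wₙ : ∀ x → Cyl Wsys x → Wₙ x
    W⇒Wₙ x (z≥0 , w) =
      let -Q≤a , a≤Q , 0≤c₀ , 0≤c₁ = W-bounds w
          c≥0 : ∀ i → 0ℚ ≤ barycentric x i
          c≥0 = λ { fzero → 0≤c₀ ; (fsuc fzero) → 0≤c₁ ; (fsuc (fsuc k)) → z≥0 k }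
      in -Q≤a , a≤Q ,
         (2 ℕ.+ m , simplex-corner , simplex-corner∈S , barycentric x , c≥0 , telescope (b x) (s x) , barycentric-coords x)
      where
      telescope : ∀ b s → 1ℚ + P * (b + Q) - s + (- (P * (b + Q)) + s) ≡ 1ℚ
      telescope b s = solve (b ∷ s ∷ P ∷ Q ∷ []) ring

    pentagon-shadow : Shadow 2
    pentagon-shadow = record
      { a = λ y → y fzero ; b = λ y → y (fsuc fzero) ; s = λ _ → 0ℚ
      ; a-affine = coord-affine fzero ; b-affine = coord-affine (fsuc fzero) ; s-affine = zero-affine }

    1-Q≤Q-1 : - (Q + - 1ℚ) ≤ Q + - 1ℚ
    1-Q≤Q-1 = ≤-from (nonNeg-+ 0≤Q-1 0≤Q-1) (solve (Q ∷ []) ring)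

    upper-edge⇒P : ∀ {u} → - (Q + - 1ℚ) ≤ u → u ≤ Q + - 1ℚ → ⟦ Psys ⟧ u 1ℚ 0ℚ
    upper-edge⇒P {u} lower upper =
        ≤-from 0≤1 (solve (u ∷ []) ring)
      ▸ ≤-from 0≤1 (solve (u ∷ []) ring)
      ▸ ≤-from (slack upper) (solve (u ∷ Q ∷ []) ring)
      ▸ ≤-from (slack lower) (solve (u ∷ Q ∷ []) ring)
      ▸ ≤-from (nonNeg-* 0≤P-1 (slack upper)) (modulo-relations 1ℚ 0ℚ (solve (u ∷ P ∷ Q ∷ Tb ∷ []) ring))
      ▸ ≤-from (nonNeg-* 0≤P-1 (slack lower)) (modulo-relations 1ℚ 0ℚ (solve (u ∷ P ∷ Q ∷ Tb ∷ []) ring))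
      ▸ []

    apex⇒P : ⟦ Psys ⟧ 0ℚ Tb 0ℚ
    apex⇒P =
        ≤-from 0≤Tb (solve (Tb ∷ []) ring)
      ▸ ≤-from 0≤1 (solve (Tb ∷ []) ring)
      ▸ ≤-from (nonNeg-* 0≤P-1 0≤Tb) (modulo-relations 0ℚ (- 1ℚ) (solve (P ∷ Q ∷ Tb ∷ []) ring))
      ▸ ≤-from (nonNeg-* 0≤P-1 0≤Tb) (modulo-relations 0ℚ (- 1ℚ) (solve (P ∷ Q ∷ Tb ∷ []) ring))
      ▸ ≤-from 0≤0 (modulo-relations 0ℚ (- P) (solve (P ∷ Q ∷ Tb ∷ []) ring))
      ▸ ≤-from 0≤0 (modulo-relations 0ℚ (- P) (solve (P ∷ Q ∷ Tb ∷ []) ring))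
      ▸ []

    -Q≤Q : - Q ≤ Q
    -Q≤Q = ≤-from (nonNeg-+ 0≤Q 0≤Q) (solve (Q ∷ []) ring)

    AxisFace-right : AxisFace Q 0ℚ
    AxisFace-right = ≤-from (nonNeg-+ 0≤Q 0≤Q) (solve (Q ∷ []) ring) , ≤-from 0≤0 (solve (Q ∷ []) ring) , 0≤0 , 0≤1

    AxisFace-left : AxisFace (- Q) 0ℚ
    AxisFace-left = ≤-from 0≤0 (solve (Q ∷ []) ring) , ≤-from (nonNeg-+ 0≤Q 0≤Q) (solve (Q ∷ []) ring) , 0≤0 , 0≤1

    AxisFace-origin : AxisFace 0ℚ 1ℚ
    AxisFace-origin = ≤-from 0≤0 (solve (Q ∷ []) ring) , ≤-from 0≤0 (solve (Q ∷ []) ring) , 0≤1 , ℚP.≤-refl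

    PentagonVertex-coordinates : ∀ {y} → PentagonVertex y → Σ (ℚ × ℚ) λ (u , v) → (y ≋ pt2 u v) × ⟦ Psys ⟧ u v 0ℚ
    PentagonVertex-coordinates (inj₁ y≋) = (Q , 0ℚ) , y≋ , AxisFace⇒P AxisFace-right
    PentagonVertex-coordinates (inj₂ (inj₁ y≋)) = (- Q , 0ℚ) , y≋ , AxisFace⇒P AxisFace-left
    PentagonVertex-coordinates (inj₂ (inj₂ (inj₁ y≋))) =
      (Q + - 1ℚ , 1ℚ) , y≋ , upper-edge⇒P 1-Q≤Q-1 ℚP.≤-refl
    PentagonVertex-coordinates (inj₂ (inj₂ (inj₂ (inj₁ y≋)))) =
      (- (Q + - 1ℚ) , 1ℚ) , y≋ , upper-edge⇒P ℚP.≤-refl 1-Q≤Q-1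
    PentagonVertex-coordinates (inj₂ (inj₂ (inj₂ (inj₂ y≋)))) = (0ℚ , Tb) , y≋ , apex⇒P

    PentagonVertex⇒P : ∀ y → PentagonVertex y → ⟦ Psys ⟧ (y fzero) (y (fsuc fzero)) 0ℚ
    PentagonVertex⇒P y vertex =
      let (u , v) , y≋ , u,v∈P = PentagonVertex-coordinates vertex
      in subst₂ (λ u v → ⟦ Psys ⟧ u v 0ℚ) (sym (y≋ fzero)) (sym (y≋ (fsuc fzero))) u,v∈P

    Pₙ⇒P : ∀ x → Pₙ x → Cyl Psys x
    Pₙ⇒P x = Conv-Cyl Psys generator
      where
      generator : ∀ x → (P′ ∪ˢ EVerts (2 ℕ.+ m)) x → Cyl Psys x
      generator x (inj₁ (y , y∈Pent , x≋)) =
        Cyl-intro {x = x} (λ k → subst (0ℚ ≤_) (sym (x≋ (fsuc (fsuc k)))) 0≤0) (x≋ fzero) (x≋ (fsuc fzero))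
                  (trans (Σᶠ-cong (λ k → x≋ (fsuc (fsuc k)))) (Σᶠ-0 {m}))
                  (Conv-⟦⟧ pentagon-shadow Psys PentagonVertex⇒P y∈Pent)
      generator x (inj₂ (suc (suc k) , s≤s (s≤s _) , s≤s (s≤s k<m) , x≋eN)) =
        Cyl-intro {x = x} (λ j → subst (0ℚ ≤_) (sym (x≋eN (fsuc (fsuc j)))) (eN-nonNeg k j)) (x≋eN fzero) (x≋eN (fsuc fzero))
                  (trans (Σᶠ-cong (λ j → x≋eN (fsuc (fsuc j)))) (Σᶠ-eN k k<m))
                  (AxisFace⇒P AxisFace-origin)

    P⇒Pₙ : ∀ x → Cyl Psys x → Pₙ x
    P⇒Pₙ x (z≥0 , h) = _ , prismatoid pentagon originOnly , prismatoid⁺ (P′ ∪ˢ EVerts (2 ℕ.+ m)) base∈P′ top∈E ,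
                     Hull₃-lift z≥0 (P-hull (Σᶠ-nonNeg z≥0) h)
      where
      pentagon-vertex : ∀ i → PentagonVertex (pt2 (proj₁ (pentagon i)) (proj₂ (pentagon i)))
      pentagon-vertex fzero = inj₁ (λ _ → refl)
      pentagon-vertex (fsuc fzero) = inj₂ (inj₁ (λ _ → refl))
      pentagon-vertex (fsuc (fsuc fzero)) = inj₂ (inj₂ (inj₁ (λ _ → refl)))
      pentagon-vertex (fsuc (fsuc (fsuc fzero))) = inj₂ (inj₂ (inj₂ (inj₁ (λ _ → refl))))
      pentagon-vertex (fsuc (fsuc (fsuc (fsuc fzero)))) = inj₂ (inj₂ (inj₂ (inj₂ (λ _ → refl))))
      base∈P′ : ∀ i → (P′ ∪ˢ EVerts (2 ℕ.+ m)) (base (pentagon i))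
      base∈P′ i = inj₁ (_ , Conv-singleton {R = PentagonVertex} (pentagon-vertex i) , base≋emb2 (pentagon i))
      top∈E : ∀ i k → (P′ ∪ˢ EVerts (2 ℕ.+ m)) (top (originOnly i) k)
      top∈E fzero k = inj₂ (suc (suc (toℕ k)) , s≤s (s≤s z≤n) , s≤s (s≤s (toℕ<n k)) , top≋eN)
        where
        top≋eN : top origin k ≋ eN (suc (suc (toℕ k)))
        top≋eN fzero = refl
        top≋eN (fsuc fzero) = refl
        top≋eN (fsuc (fsuc j)) = refl

    W⇒H : ∀ {a b s} → ⟦ Wsys ⟧ a b s → ⟦ Hsys ⟧ a b s
    W⇒H {a} {b} {s} (w₁ ▸ w₂ ▸ w₃ ▸ w₄ ▸ []) =
        ≤-from (nonNeg-+ (slack w₄) (nonNeg-* 0≤P (slack w₃))) (solve (a ∷ b ∷ s ∷ P ∷ Q ∷ []) ring)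
      ▸ w₁
      ▸ w₂
      ▸ ≤-from (nonNeg-+ (nonNeg-+ (slack w₁) (nonNeg-* 0≤1+PQ (slack w₃))) (nonNeg-* 0≤Q (slack w₄)))
               (solve (a ∷ b ∷ s ∷ P ∷ Q ∷ []) ring)
      ▸ ≤-from (nonNeg-+ (nonNeg-+ (slack w₂) (nonNeg-* 0≤1+PQ (slack w₃))) (nonNeg-* 0≤Q (slack w₄)))
               (solve (a ∷ b ∷ s ∷ P ∷ Q ∷ []) ring)
      ▸ ≤-from (nonNeg-+ (nonNeg-+ (nonNeg-+ (nonNeg-* 0≤P-1 (slack w₁)) (nonNeg-* 0≤P²Q+P² (slack w₃)))
                                   (nonNeg-* 0≤PQ (slack w₄))) 0≤Q[[P-1]²+P])
               (solve (a ∷ b ∷ s ∷ P ∷ Q ∷ []) ring)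
      ▸ ≤-from (nonNeg-+ (nonNeg-+ (nonNeg-+ (nonNeg-* 0≤P-1 (slack w₂)) (nonNeg-* 0≤P²Q+P² (slack w₃)))
                                   (nonNeg-* 0≤PQ (slack w₄))) 0≤Q[[P-1]²+P])
               (solve (a ∷ b ∷ s ∷ P ∷ Q ∷ []) ring)
      ▸ w₄
      ▸ []
      where
      0≤PQ : 0ℚ ≤ P * Q
      0≤PQ = nonNeg-* 0≤P 0≤Q
      0≤1+PQ : 0ℚ ≤ 1ℚ + P * Q
      0≤1+PQ = nonNeg-+ 0≤1 0≤PQ
      0≤P²Q+P² : 0ℚ ≤ P * P * Q + P * P
      0≤P²Q+P² = nonNeg-+ (nonNeg-* (nonNeg-* 0≤P 0≤P) 0≤Q) (nonNeg-* 0≤P 0≤P)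
      0≤Q[[P-1]²+P] : 0ℚ ≤ Q * ((P - 1ℚ) * (P - 1ℚ) + P)
      0≤Q[[P-1]²+P] = nonNeg-* 0≤Q (nonNeg-+ (nonNeg-* 0≤P-1 0≤P-1) 0≤P)

    P⇒H : ∀ {a b s} → 0ℚ ≤ s → ⟦ Psys ⟧ a b s → ⟦ Hsys ⟧ a b s
    P⇒H {a} {b} {s} 0≤s (p₁ ▸ p₂ ▸ p₃ ▸ p₄ ▸ p₅ ▸ p₆ ▸ []) =
        p₂
      ▸ ≤-from (nonNeg-+ (nonNeg-+ (slack p₃) (slack p₁)) (nonNeg-* 0≤Q 0≤s)) (solve (a ∷ b ∷ s ∷ Q ∷ []) ring)
      ▸ ≤-from (nonNeg-+ (nonNeg-+ (slack p₄) (slack p₁)) (nonNeg-* 0≤Q 0≤s)) (solve (a ∷ b ∷ s ∷ Q ∷ []) ring)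
      ▸ p₃
      ▸ p₄
      ▸ p₅
      ▸ p₆
      ▸ ≤-from (nonNeg-+ (nonNeg-+ (nonNeg-* 0≤P (slack p₁)) (slack p₂)) (nonNeg-* 0≤P 0≤Q)) (solve (a ∷ b ∷ s ∷ P ∷ Q ∷ []) ring)
      ▸ []

    H⇒W : ∀ {a b s} → b ≤ - Q → ⟦ Hsys ⟧ a b s → ⟦ Wsys ⟧ a b s
    H⇒W {a} {b} {s} b≤-Q (_ ▸ h₂ ▸ h₃ ▸ _ ▸ _ ▸ _ ▸ _ ▸ h₈ ▸ []) =
      h₂ ▸ h₃ ▸ ≤-from (slack b≤-Q) (solve (a ∷ b ∷ s ∷ Q ∷ []) ring) ▸ h₈ ▸ []

    H⇒M : ∀ {a b s} → - Q ≤ b → b ≤ 0ℚ → ⟦ Hsys ⟧ a b s → ⟦ Msys ⟧ a b s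
    H⇒M {a} {b} {s} -Q≤b b≤0 (h₁ ▸ h₂ ▸ h₃ ▸ h₄ ▸ h₅ ▸ _) =
      h₁ ▸ h₂ ▸ h₃ ▸ ≤-from (slack -Q≤b) (solve (a ∷ b ∷ s ∷ Q ∷ []) ring) ▸ ≤-from (slack b≤0) (solve (a ∷ b ∷ s ∷ []) ring) ▸ h₄ ▸ h₅ ▸ []

    H⇒P : ∀ {a b s} → 0ℚ ≤ b → ⟦ Hsys ⟧ a b s → ⟦ Psys ⟧ a b s
    H⇒P {a} {b} {s} 0≤b (h₁ ▸ _ ▸ _ ▸ h₄ ▸ h₅ ▸ h₆ ▸ h₇ ▸ _) =
      ≤-from (slack 0≤b) (solve (a ∷ b ∷ s ∷ []) ring) ▸ h₁ ▸ h₄ ▸ h₅ ▸ h₆ ▸ h₇ ▸ []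

    Mₙ : PSet (2 ℕ.+ m)
    Mₙ = InConv (prismatoid Mbase Mtop)

    LowerFace-right : ∀ {h} → 0ℚ ≤ h → h ≤ 1ℚ → LowerFace Q h
    LowerFace-right 0≤h h≤1 = -Q≤Q , ℚP.≤-refl , 0≤h , h≤1

    LowerFace-left : ∀ {h} → 0ℚ ≤ h → h ≤ 1ℚ → LowerFace (- Q) h
    LowerFace-left 0≤h h≤1 = ℚP.≤-refl , -Q≤Q , 0≤h , h≤1

    lowerEdge⇒ : ∀ {L} → (∀ {u h} → LowerFace u h → ⟦ L ⟧ u (- Q) h) →
              ∀ i {h} → 0ℚ ≤ h → h ≤ 1ℚ → ⟦ L ⟧ (proj₁ (lowerEdge i)) (proj₂ (lowerEdge i)) h
    lowerEdge⇒ FFace⇒L fzero 0≤h h≤1 = FFace⇒L (LowerFace-right 0≤h h≤1)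
    lowerEdge⇒ FFace⇒L (fsuc fzero) 0≤h h≤1 = FFace⇒L (LowerFace-left 0≤h h≤1)

    axisEdge⇒ : ∀ {L} → (∀ {u h} → AxisFace u h → ⟦ L ⟧ u 0ℚ h) → ∀ i → ⟦ L ⟧ (proj₁ (axisEdge i)) (proj₂ (axisEdge i)) 0ℚ
    axisEdge⇒ TFace⇒L fzero = TFace⇒L AxisFace-right
    axisEdge⇒ TFace⇒L (fsuc fzero) = TFace⇒L AxisFace-left

    originOnly⇒ : ∀ {L} → ⟦ L ⟧ 0ℚ 0ℚ 1ℚ → ∀ i → ⟦ L ⟧ (proj₁ (originOnly i)) (proj₂ (originOnly i)) 1ℚ
    originOnly⇒ origin∈L fzero = origin∈L

    Mbase⇒M : ∀ i → ⟦ Msys ⟧ (proj₁ (Mbase i)) (proj₂ (Mbase i)) 0ℚ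
    Mbase⇒M fzero = LowerFace⇒M (LowerFace-right 0≤0 0≤1)
    Mbase⇒M (fsuc fzero) = LowerFace⇒M (LowerFace-left 0≤0 0≤1)
    Mbase⇒M (fsuc (fsuc fzero)) = AxisFace⇒M AxisFace-right
    Mbase⇒M (fsuc (fsuc (fsuc fzero))) = AxisFace⇒M AxisFace-left

    Mtop⇒M : ∀ i → ⟦ Msys ⟧ (proj₁ (Mtop i)) (proj₂ (Mtop i)) 1ℚ
    Mtop⇒M fzero = LowerFace⇒M (LowerFace-right 0≤1 ℚP.≤-refl)
    Mtop⇒M (fsuc fzero) = LowerFace⇒M (LowerFace-left 0≤1 ℚP.≤-refl)
    Mtop⇒M (fsuc (fsuc fzero)) = AxisFace⇒M AxisFace-origin

    Mₙ⇒M : ∀ x → Mₙ x → Cyl Msys x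
    Mₙ⇒M x h = InConv-Cyl {V = prismatoid Mbase Mtop} Msys h (prismatoid-Cyl Mbase⇒M Mtop⇒M)

    M⇒Mₙ : ∀ x → Cyl Msys x → Mₙ x
    M⇒Mₙ x (z≥0 , h) = Hull₃-lift z≥0 (M-hull (Σᶠ-nonNeg z≥0) h)

    Mvertex∈W∪P : ∀ ι → (Wₙ ∪ˢ Pₙ) (prismatoid Mbase Mtop ι)
    Mvertex∈W∪P = prismatoid⁺ (Wₙ ∪ˢ Pₙ) on-base on-top
      where
      on-base : ∀ i → (Wₙ ∪ˢ Pₙ) (base (Mbase i))
      on-base fzero = inj₁ (W⇒Wₙ (base lowerRight) (base-Cyl (LowerFace⇒W (LowerFace-right 0≤0 0≤1))))
      on-base (fsuc fzero) = inj₁ (W⇒Wₙ (base lowerLeft) (base-Cyl (LowerFace⇒W (LowerFace-left 0≤0 0≤1))))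
      on-base (fsuc (fsuc fzero)) = inj₂ (P⇒Pₙ (base right) (base-Cyl (AxisFace⇒P AxisFace-right)))
      on-base (fsuc (fsuc (fsuc fzero))) = inj₂ (P⇒Pₙ (base left) (base-Cyl (AxisFace⇒P AxisFace-left)))
      on-top : ∀ i k → (Wₙ ∪ˢ Pₙ) (top (Mtop i) k)
      on-top fzero k = inj₁ (W⇒Wₙ (top lowerRight k) (top-Cyl (LowerFace⇒W (LowerFace-right 0≤1 ℚP.≤-refl)) k))
      on-top (fsuc fzero) k = inj₁ (W⇒Wₙ (top lowerLeft k) (top-Cyl (LowerFace⇒W (LowerFace-left 0≤1 ℚP.≤-refl)) k))
      on-top (fsuc (fsuc fzero)) k = inj₂ (P⇒Pₙ (top origin k) (top-Cyl (AxisFace⇒P AxisFace-origin) k))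

    Hₙ⇒H : ∀ x → Hₙ x → Cyl Hsys x
    Hₙ⇒H x = Conv-Cyl Hsys generator
      where
      generator : ∀ y → (Wₙ ∪ˢ Pₙ) y → Cyl Hsys y
      generator y (inj₁ y∈W) = let z≥0 , h = Wₙ⇒W y y∈W in z≥0 , W⇒H h
      generator y (inj₂ y∈P) = let z≥0 , h = Pₙ⇒P y y∈P in z≥0 , P⇒H (Σᶠ-nonNeg z≥0) h

    H⇒W∪M∪P : ∀ x → Cyl Hsys x → ((Wₙ ∪ˢ Mₙ) ∪ˢ Pₙ) x
    H⇒W∪M∪P x (z≥0 , h) = [ deep , (λ -Q≤b → [ middle -Q≤b , high ]′ (ℚP.≤-total (b x) 0ℚ)) ]′ (ℚP.≤-total (b x) (- Q))
      where
      deep : b x ≤ - Q → ((Wₙ ∪ˢ Mₙ) ∪ˢ Pₙ) x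
      deep b≤-Q = inj₁ (inj₁ (W⇒Wₙ x (z≥0 , H⇒W b≤-Q h)))
      middle : - Q ≤ b x → b x ≤ 0ℚ → ((Wₙ ∪ˢ Mₙ) ∪ˢ Pₙ) x
      middle -Q≤b b≤0 = inj₁ (inj₂ (M⇒Mₙ x (z≥0 , H⇒M -Q≤b b≤0 h)))
      high : 0ℚ ≤ b x → ((Wₙ ∪ˢ Mₙ) ∪ˢ Pₙ) x
      high 0≤b = inj₂ (P⇒Pₙ x (z≥0 , H⇒P 0≤b h))

    H≐W∪M∪P : Hₙ ≐ ((Wₙ ∪ˢ Mₙ) ∪ˢ Pₙ)
    H≐W∪M∪P x = (λ x∈H → H⇒W∪M∪P x (Hₙ⇒H x x∈H)) , from-pieces
      where
      from-pieces : ((Wₙ ∪ˢ Mₙ) ∪ˢ Pₙ) x → Hₙ x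
      from-pieces (inj₁ (inj₁ x∈W)) = Conv-singleton {R = Wₙ ∪ˢ Pₙ} (inj₁ x∈W)
      from-pieces (inj₁ (inj₂ x∈M)) = _ , prismatoid Mbase Mtop , Mvertex∈W∪P , x∈M
      from-pieces (inj₂ x∈P) = Conv-singleton {R = Wₙ ∪ˢ Pₙ} (inj₂ x∈P)

    W∩M⇒lowerFace : ∀ x → (Wₙ ∩ˢ Mₙ) x → InConv (prismatoid lowerEdge lowerEdge) x
    W∩M⇒lowerFace x (x∈W , x∈M) =
      let z≥0 , hW = Wₙ⇒W x x∈W
          b≡-Q , face = WM⇒LowerFace (Σᶠ-nonNeg z≥0) hW (proj₂ (Mₙ⇒M x x∈M))
      in Hull₃-lift z≥0 (subst (λ β → Hull₃ lowerEdge lowerEdge (a x) β (s x)) (sym b≡-Q) (LowerFace-hull face))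

    lowerFace⇒W∩M : ∀ x → InConv (prismatoid lowerEdge lowerEdge) x → (Wₙ ∩ˢ Mₙ) x
    lowerFace⇒W∩M x h = W⇒Wₙ x (InConv-Cyl {V = prismatoid lowerEdge lowerEdge} Wsys h (prismatoid-Cyl (λ i → lowerEdge⇒ LowerFace⇒W i 0≤0 0≤1)
                                                                                   (λ i → lowerEdge⇒ LowerFace⇒W i 0≤1 ℚP.≤-refl))) ,
                M⇒Mₙ x (InConv-Cyl {V = prismatoid lowerEdge lowerEdge} Msys h (prismatoid-Cyl (λ i → lowerEdge⇒ LowerFace⇒M i 0≤0 0≤1)
                                                                                   (λ i → lowerEdge⇒ LowerFace⇒M i 0≤1 ℚP.≤-refl)))

    M∩P⇒axisFace : ∀ x → (Mₙ ∩ˢ Pₙ) x → InConv (prismatoid axisEdge originOnly) x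
    M∩P⇒axisFace x (x∈M , x∈P) =
      let z≥0 , hM = Mₙ⇒M x x∈M
          b≡0 , face = MP⇒AxisFace (Σᶠ-nonNeg z≥0) hM (proj₂ (Pₙ⇒P x x∈P))
      in Hull₃-lift z≥0 (subst (λ β → Hull₃ axisEdge originOnly (a x) β (s x)) (sym b≡0) (AxisFace-hull face))

    axisFace⇒M∩P : ∀ x → InConv (prismatoid axisEdge originOnly) x → (Mₙ ∩ˢ Pₙ) x
    axisFace⇒M∩P x h = M⇒Mₙ x (InConv-Cyl {V = prismatoid axisEdge originOnly} Msys h (prismatoid-Cyl (axisEdge⇒ AxisFace⇒M) (originOnly⇒ (AxisFace⇒M AxisFace-origin)))) ,
                P⇒Pₙ x (InConv-Cyl {V = prismatoid axisEdge originOnly} Psys h (prismatoid-Cyl (axisEdge⇒ AxisFace⇒P) (originOnly⇒ (AxisFace⇒P AxisFace-origin))))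

    -Q-integral : Integral (- Q)
    -Q-integral = Integral-neg Q-integral

    0-integral : Integral 0ℚ
    0-integral = + 0 , refl

    lowerEdge-integral : ∀ i → Integral² (lowerEdge i)
    lowerEdge-integral fzero = Q-integral , -Q-integral
    lowerEdge-integral (fsuc fzero) = -Q-integral , -Q-integral

    axisEdge-integral : ∀ i → Integral² (axisEdge i)
    axisEdge-integral fzero = Q-integral , 0-integral
    axisEdge-integral (fsuc fzero) = -Q-integral , 0-integral

    originOnly-integral : ∀ i → Integral² (originOnly i)
    originOnly-integral fzero = 0-integral , 0-integral

    Mbase-integral : ∀ i → Integral² (Mbase i)
    Mbase-integral fzero = Q-integral , -Q-integral
    Mbase-integral (fsuc fzero) = -Q-integral , -Q-integral
    Mbase-integral (fsuc (fsuc fzero)) = Q-integral , 0-integral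
    Mbase-integral (fsuc (fsuc (fsuc fzero))) = -Q-integral , 0-integral

    Mtop-integral : ∀ i → Integral² (Mtop i)
    Mtop-integral fzero = Q-integral , -Q-integral
    Mtop-integral (fsuc fzero) = -Q-integral , -Q-integral
    Mtop-integral (fsuc (fsuc fzero)) = 0-integral , 0-integral

    decomposition : Σ (PSet (2 ℕ.+ m)) λ M → IsPolytope M
        × (Hₙ ≐ ((Wₙ ∪ˢ M) ∪ˢ Pₙ))
        × IsLatticePolytope (Wₙ ∩ˢ M)
        × IsLatticePolytope M
        × IsLatticePolytope (M ∩ˢ Pₙ)
    decomposition =
      Mₙ ,
      (_ , prismatoid Mbase Mtop , λ _ → (λ h → h) , (λ h → h)) ,
      H≐W∪M∪P ,
      lattice-polytope (prismatoid lowerEdge lowerEdge) (λ x → W∩M⇒lowerFace x , lowerFace⇒W∩M x)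
                       (prismatoid-integral lowerEdge-integral lowerEdge-integral) ,
      lattice-polytope (prismatoid Mbase Mtop) (λ _ → (λ h → h) , (λ h → h))
                       (prismatoid-integral Mbase-integral Mtop-integral) ,
      lattice-polytope (prismatoid axisEdge originOnly) (λ x → M∩P⇒axisFace x , axisFace⇒M∩P x)
                       (prismatoid-integral axisEdge-integral originOnly-integral)

  ι : ℕ → ℚ
  ι n = + n / 1

  toℚᵘ-ι : ∀ n → toℚᵘ (ι n) ℚᵘ.≃ ℚᵘ.mkℚᵘ (+ n) 0
  toℚᵘ-ι n = ℚP.toℚᵘ-fromℚᵘ (ℚᵘ.mkℚᵘ (+ n) 0)

  ι-+ : ∀ m n → ι (m ℕ.+ n) ≡ ι m + ι n
  ι-+ m n = ℚP.toℚᵘ-injective (begin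
    toℚᵘ (ι (m ℕ.+ n))                       ≈⟨ toℚᵘ-ι (m ℕ.+ n) ⟩
    ℚᵘ.mkℚᵘ (+ (m ℕ.+ n)) 0                  ≈⟨ ℚᵘ.*≡* cross ⟩
    ℚᵘ.mkℚᵘ (+ m) 0 ℚᵘ.+ ℚᵘ.mkℚᵘ (+ n) 0     ≈⟨ ℚᵘP.+-cong (toℚᵘ-ι m) (toℚᵘ-ι n) ⟨
    toℚᵘ (ι m) ℚᵘ.+ toℚᵘ (ι n)               ≈⟨ ℚP.toℚᵘ-homo-+ (ι m) (ι n) ⟨
    toℚᵘ (ι m + ι n)                         ∎)
    where
    open ℚᵘP.≃-Reasoning
    cross : + (m ℕ.+ n) ℤ.* + 1 ≡ (+ m ℤ.* + 1 ℤ.+ + n ℤ.* + 1) ℤ.* + 1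
    cross rewrite ℤP.*-identityʳ (+ m) | ℤP.*-identityʳ (+ n) | ℤP.*-identityʳ (+ (m ℕ.+ n)) = ℤP.pos-+ m n

  ι-* : ∀ m n → ι (m ℕ.* n) ≡ ι m * ι n
  ι-* m n = ℚP.toℚᵘ-injective (begin
    toℚᵘ (ι (m ℕ.* n))                       ≈⟨ toℚᵘ-ι (m ℕ.* n) ⟩
    ℚᵘ.mkℚᵘ (+ (m ℕ.* n)) 0                  ≈⟨ ℚᵘ.*≡* (cong (ℤ._* + 1) (ℤP.pos-* m n)) ⟩
    ℚᵘ.mkℚᵘ (+ m) 0 ℚᵘ.* ℚᵘ.mkℚᵘ (+ n) 0     ≈⟨ ℚᵘP.*-cong (toℚᵘ-ι m) (toℚᵘ-ι n) ⟨
    toℚᵘ (ι m) ℚᵘ.* toℚᵘ (ι n)               ≈⟨ ℚP.toℚᵘ-homo-* (ι m) (ι n) ⟨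
    toℚᵘ (ι m * ι n)                         ∎)
    where open ℚᵘP.≃-Reasoning

  /-*-cancel : ∀ i d .{{_ : NonZero d}} → ι d * (i / d) ≡ i / 1
  /-*-cancel i (suc d) = ℚP.toℚᵘ-injective (begin
    toℚᵘ (ι (suc d) * (i / suc d))                   ≈⟨ ℚP.toℚᵘ-homo-* (ι (suc d)) (i / suc d) ⟩
    toℚᵘ (ι (suc d)) ℚᵘ.* toℚᵘ (i / suc d)           ≈⟨ ℚᵘP.*-cong (toℚᵘ-ι (suc d)) (ℚP.toℚᵘ-fromℚᵘ (ℚᵘ.mkℚᵘ i d)) ⟩
    ℚᵘ.mkℚᵘ (+ suc d) 0 ℚᵘ.* ℚᵘ.mkℚᵘ i d             ≈⟨ ℚᵘ.*≡* cross ⟩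
    ℚᵘ.mkℚᵘ i 0                                      ≈⟨ ℚP.toℚᵘ-fromℚᵘ (ℚᵘ.mkℚᵘ i 0) ⟨
    toℚᵘ (i / 1)                                     ∎)
    where
    open ℚᵘP.≃-Reasoning
    cross : (+ suc d ℤ.* i) ℤ.* + 1 ≡ i ℤ.* + (1 ℕ.* suc d)
    cross rewrite ℤP.*-identityʳ (+ suc d ℤ.* i) | ℕP.*-identityˡ (suc d) = ℤP.*-comm (+ suc d) i

  ι-mono : ∀ {m n} → m ℕ.≤ n → ι m ≤ ι n
  ι-mono {m} {n} m≤n = ℚP.toℚᵘ-cancel-≤
    (ℚᵘP.≤-respʳ-≃ (ℚᵘP.≃-sym (toℚᵘ-ι n)) (ℚᵘP.≤-respˡ-≃ (ℚᵘP.≃-sym (toℚᵘ-ι m))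
      (ℚᵘ.*≤* (ℤP.*-monoʳ-≤-nonNeg (+ 1) (ℤ.+≤+ m≤n)))))

  q≡p²-p+1 : ∀ p .{{_ : NonZero p}} → qQ p ≡ ι p * ι p - ι p + 1ℚ
  q≡p²-p+1 p = begin
    ι (p ℕ.* p ℕ.∸ p ℕ.+ 1)              ≡⟨ ι-+ (p ℕ.* p ℕ.∸ p) 1 ⟩
    ι (p ℕ.* p ℕ.∸ p) + 1ℚ               ≡⟨ cong (_+ 1ℚ) (add-sub (ι (p ℕ.* p ℕ.∸ p)) (ι p)) ⟩
    ι (p ℕ.* p ℕ.∸ p) + ι p - ι p + 1ℚ   ≡⟨ cong (λ t → t - ι p + 1ℚ) p²-p+p ⟩
    ι p * ι p - ι p + 1ℚ                 ∎
    where
    open ≡-Reasoning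
    add-sub : ∀ x y → x ≡ x + y - y
    add-sub x y = solve (x ∷ y ∷ []) ring
    p²-p+p : ι (p ℕ.* p ℕ.∸ p) + ι p ≡ ι p * ι p
    p²-p+p = trans (sym (ι-+ (p ℕ.* p ℕ.∸ p) p)) (trans (cong ι (ℕP.m∸n+n≡m (ℕP.m≤m*n p p))) (ι-* p p))

open import Data.Nat using (_≤_)
open Polytopes using (module Construction; ι; q≡p²-p+1; /-*-cancel; ι-mono)

lemma3p2 : (p : ℕ) → .{{_ : NonZero p}} → (n : ℕ) → 3 ≤ n →
    Σ (PSet n) λ M → IsPolytope M
    × (Hn p n ≐ ((Wn p n ∪ˢ M) ∪ˢ Pn p n))
    × IsLatticePolytope (Wn p n ∩ˢ M)
    × IsLatticePolytope M
    × IsLatticePolytope (M ∩ˢ Pn p n)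
lemma3p2 p (suc (suc (suc m))) (s≤s (s≤s (s≤s _))) =
  Construction.decomposition (suc m) (ι p) (qQ p) (+ qℕ p / p) (+ 1 / p)
    (q≡p²-p+1 p) (/-*-cancel (+ qℕ p) p) (/-*-cancel (+ 1) p) (ι-mono (ℕ.>-nonZero⁻¹ p)) (+ qℕ p , refl)
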